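{- Let $G_n$ be a graph of order $n$ with Laplacian matrix $L(G_n)$, and let $k\ge 1$ and $p\geq k$ be integers. Let $G_n\vee K_k$ be the join of $G_n$ and $K_k$, and let $K_{p}\circ_{k}(G_{n}\vee K_k)$ be the graph obtained by identifying the $k$ vertices of the $K_k$ in $G_n\vee K_k$ with $k$ vertices of $K_p$. Let $T$ be the set of these $k$ identified vertices, and write $M=(L(G_n)+kI_n)^{ -1}$, whose rows and columns are indexed by $V(G_n)$. Then the resistance distances $r_{ij}$ in $K_{p}\circ_{k}(G_{n}\vee K_k)$ are: (i) for any distinct $v_i, v_j\in T$, $r_{ij}= \frac{2}{p+n}$; (ii) for $v_i\in T$, $v_j\in V(K_{p})\setminus T$, $r_{ij}= \frac{k(2p+n)+n}{kp(p+n)}$; (iii) for $v_i\in T$, $v_j\in V(G_{n})$, $r_{ij}= \frac{k-1}{k(p+n)}+M_{jj}$; (iv) for any distinct $v_i, v_j\in V(K_{p})\setminus T$, $r_{ij}= \frac{2}{p}$; (v) for $v_i\in V(K_{p})\setminus T$, $v_j\in V(G_{n})$, $r_{ij}= \frac{k+1}{kp}+M_{jj}$; (vi) for any distinct $v_i, v_j\in V(G_{n})$, $r_{ij}= M_{ii}+M_{jj}-2M_{ij}$.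
   Context: The join $G\vee H$ of disjoint graphs $G,H$ is obtained from $G\cup H$ by adding all edges between $V(G)$ and $V(H)$. The Laplacian of a graph is $L=D-A$ ($D$ the diagonal degree matrix, $A$ the adjacency matrix). The resistance distance $r_{ij}$ between vertices of a connected graph is the effective resistance between them when every edge is a resistor of $1\Omega$; equivalently $r_{ij}=l^{\#}_{ii}+l^{\#}_{jj}-2l^{\#}_{ij}$ with $L^{\#}$ the group inverse of the Laplacian. -}

module Defs where

open import Data.Nat as ℕ using (ℕ; zero; suc)
open import Data.Integer using (+_)
open import Data.Rational using (ℚ; 0ℚ; 1ℚ; _+_; _*_; _-_; _/_)
open import Data.Fin using (Fin; zero; suc; toℕ; splitAt; _≟_)
open import Data.Sum using (_⊎_; inj₁; inj₂)
open import Data.Bool using (Bool; true; false; if_then_else_)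
open import Relation.Nullary using (does)
open import Relation.Binary.PropositionalEquality using (_≡_)

-- a / b as a rational number (for b ≠ 0; the value for b = 0 is an irrelevant default 0)
frac : ℕ → ℕ → ℚ
frac a zero    = 0ℚ
frac a (suc b) = (+ a) / suc b

ℕtoℚ : ℕ → ℚ
ℕtoℚ a = (+ a) / 1

b2q : Bool → ℚ
b2q true  = 1ℚ
b2q false = 0ℚ

sumF : ∀ {n} → (Fin n → ℚ) → ℚ
sumF {zero}  f = 0ℚ
sumF {suc n} f = f zero + sumF (λ i → f (suc i))

Mat : ℕ → Set
Mat n = Fin n → Fin n → ℚ

_·_ : ∀ {n} → Mat n → Mat n → Mat n
(A · B) i j = sumF (λ l → A i l * B l j)

Id : ∀ {n} → Mat n
Id i j = if does (i ≟ j) then 1ℚ else 0ℚ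

_≐_ : ∀ {n} → Mat n → Mat n → Set
A ≐ B = ∀ i j → A i j ≡ B i j

Graph : ℕ → Set
Graph n = Fin n → Fin n → Bool

IsSimple : ∀ {n} → Graph n → Set
IsSimple {n} G = (∀ i j → G i j ≡ G j i) × (∀ i → G i i ≡ false)
  where open import Data.Product using (_×_)

degree : ∀ {n} → Graph n → Fin n → ℚ
degree G i = sumF (λ j → b2q (G i j))

Laplacian : ∀ {n} → Graph n → Mat n
Laplacian G i j = (if does (i ≟ j) then degree G i else 0ℚ) - b2q (G i j)

shiftDiag : ∀ {n} → Mat n → ℕ → Mat n
shiftDiag A k i j = A i j + ℕtoℚ k * Id i j

IsInverse : ∀ {n} → Mat n → Mat n → Set
IsInverse A M = ((A · M) ≐ Id) × ((M · A) ≐ Id)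
  where open import Data.Product using (_×_)

IsGroupInverse : ∀ {n} → Mat n → Mat n → Set
IsGroupInverse A X = (((A · X) · A) ≐ A) × (((X · A) · X) ≐ X) × ((A · X) ≐ (X · A))
  where open import Data.Product using (_×_)

resistance : ∀ {m} → Mat m → Fin m → Fin m → ℚ
resistance X i j = X i i + X j j - (ℕtoℚ 2 * X i j)

-- K_p ∘_k (G_n ∨ K_k) on vertex set Fin (n + p):
-- vertices (n ↑ʳ t) with toℕ t < k form T (the identified vertices),
-- the remaining (n ↑ʳ t) are V(K_p) \ T, and (i ↑ˡ p) are the vertices of G_n.
composite : ∀ n k p → Graph n → Graph (n ℕ.+ p)
composite n k p G u v with splitAt n u | splitAt n v
... | inj₁ a | inj₁ b = G a b
... | inj₁ a | inj₂ t = does (suc (toℕ t) ℕ.≤? k)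
... | inj₂ t | inj₁ b = does (suc (toℕ t) ℕ.≤? k)
... | inj₂ s | inj₂ t = Data.Bool.not (does (s ≟ t))
  where import Data.Bool

{-# OPTIONS --safe #-}
module Submission where

-- Resistances are read off from potentials: if L z = c (e_u − e_v) for a symmetric L with
-- group inverse X, then c r_uv = z_u − z_v, since (e_u − e_v)ᵀ X (e_u − e_v) = zᵀ L X L z = zᵀ L z.
-- On K_p ∘_k (G_n ∨ K_k) the Laplacian acts in closed form on the unit vectors at V(K_p), on the
-- indicators 𝟙G, 𝟙K, χT of V(G_n), V(K_p), T, and on the columns of M placed on V(G_n), because
-- the V(G_n)-block of the Laplacian is L(G_n) + kI.  Each resistance of the theorem is then
-- obtained from a short linear combination z of these vectors; in (i) and (iv) z = e_u − e_v,
-- the two vertices being twins.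

open import Defs
open import Data.Nat using (ℕ; _+_; _*_; _∸_; _≤_; _<_)
open import Data.Fin using (Fin; toℕ; _↑ˡ_; _↑ʳ_)
open import Data.Rational using (ℚ) renaming (_+_ to _+ℚ_; _-_ to _-ℚ_; _*_ to _*ℚ_)
open import Data.Product using (_×_)
open import Relation.Binary.PropositionalEquality using (_≡_; _≢_)

open import Relation.Nullary.Decidable using (dec⇒maybe; dec-true; dec-false)
open import Level using (0ℓ)
open import Data.Nat using (zero; suc; z≤n; s≤s; NonZero; >-nonZero; >-nonZero⁻¹)
open import Data.Fin using (zero; suc; _≟_; splitAt)
open import Data.Fin.Properties using (splitAt-↑ˡ; splitAt-↑ʳ; splitAt⁻¹-↑ˡ; splitAt⁻¹-↑ʳ; ↑ˡ-injective; ↑ʳ-injective)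
open import Data.Sum using (inj₁; inj₂; [_,_]′)
open import Relation.Nullary using (does; yes; no; contradiction)
open import Data.Bool using (true; false; not; if_then_else_)
open import Function using (_∘_)
open import Data.Integer using (+_)
import Data.Integer as ℤ
import Data.Integer.Properties as ℤ
import Data.Nat.Properties as ℕ
import Data.Rational.Unnormalised as ℚᵘ
import Data.Rational.Unnormalised.Properties as ℚᵘ
open import Data.Rational using (0ℚ; 1ℚ; -_; toℚᵘ)
import Data.Rational.Properties as ℚ
open import Relation.Binary.PropositionalEquality using (_≗_; refl; sym; trans; cong; cong₂; subst; module ≡-Reasoning)
open import Tactic.RingSolver using (solve-∀)
open import Relation.Binary.Bundles using (Setoid)
import Relation.Binary.Reasoning.Setoid as SetoidReasoning
open import Data.Product using (_,_; proj₁)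
open import Data.Integer.Tactic.RingSolver using () renaming (solve-∀ to ℤsolve-∀)
open import Tactic.RingSolver.Core.AlmostCommutativeRing using (AlmostCommutativeRing; fromCommutativeRing)

ℚ-ring : AlmostCommutativeRing 0ℓ 0ℓ
ℚ-ring = fromCommutativeRing ℚ.+-*-commutativeRing (λ q → dec⇒maybe (0ℚ ℚ.≟ q))

toℚᵘ-ℕtoℚ : ∀ a → toℚᵘ (ℕtoℚ a) ℚᵘ.≃ ℚᵘ.mkℚᵘ (+ a) 0
toℚᵘ-ℕtoℚ a = ℚ.toℚᵘ-fromℚᵘ (ℚᵘ.mkℚᵘ (+ a) 0)

ℕtoℚ-+ : ∀ a b → ℕtoℚ (a + b) ≡ ℕtoℚ a +ℚ ℕtoℚ b
ℕtoℚ-+ a b = ℚ.toℚᵘ-injective (ℚᵘ.≃-trans (toℚᵘ-ℕtoℚ (a + b)) (ℚᵘ.≃-sym (ℚᵘ.≃-trans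
  (ℚ.toℚᵘ-homo-+ (ℕtoℚ a) (ℕtoℚ b)) (ℚᵘ.≃-trans (ℚᵘ.+-cong (toℚᵘ-ℕtoℚ a) (toℚᵘ-ℕtoℚ b)) (ℚᵘ.*≡* eq)))))
  where
  eq : ((+ a) ℤ.* + 1 ℤ.+ (+ b) ℤ.* + 1) ℤ.* + 1 ≡ + (a + b) ℤ.* + 1
  eq = trans (ℤsolve (+ a) (+ b)) (cong (ℤ._* + 1) (sym (ℤ.pos-+ a b)))
    where
    ℤsolve : ∀ x y → (x ℤ.* + 1 ℤ.+ y ℤ.* + 1) ℤ.* + 1 ≡ (x ℤ.+ y) ℤ.* + 1
    ℤsolve = ℤsolve-∀

ℕtoℚ-* : ∀ a b → ℕtoℚ (a * b) ≡ ℕtoℚ a *ℚ ℕtoℚ b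
ℕtoℚ-* a b = ℚ.toℚᵘ-injective (ℚᵘ.≃-trans (toℚᵘ-ℕtoℚ (a * b)) (ℚᵘ.≃-sym (ℚᵘ.≃-trans
  (ℚ.toℚᵘ-homo-* (ℕtoℚ a) (ℕtoℚ b)) (ℚᵘ.≃-trans (ℚᵘ.*-cong (toℚᵘ-ℕtoℚ a) (toℚᵘ-ℕtoℚ b)) (ℚᵘ.*≡* eq)))))
  where
  eq : ((+ a) ℤ.* (+ b)) ℤ.* + 1 ≡ + (a * b) ℤ.* + 1
  eq = cong (ℤ._* + 1) (sym (ℤ.pos-* a b))

ℕtoℚ-*-frac : ∀ a D .{{_ : NonZero D}} → ℕtoℚ D *ℚ frac a D ≡ ℕtoℚ a
ℕtoℚ-*-frac a (suc d) = ℚ.toℚᵘ-injective (ℚᵘ.≃-trans (ℚ.toℚᵘ-homo-* (ℕtoℚ (suc d)) (frac a (suc d)))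
  (ℚᵘ.≃-trans (ℚᵘ.*-cong (toℚᵘ-ℕtoℚ (suc d)) (ℚ.toℚᵘ-fromℚᵘ (ℚᵘ.mkℚᵘ (+ a) d)))
    (ℚᵘ.≃-trans (ℚᵘ.*≡* eq) (ℚᵘ.≃-sym (toℚᵘ-ℕtoℚ a)))))
  where
  eq : ((+ suc d) ℤ.* (+ a)) ℤ.* + 1 ≡ + a ℤ.* + suc (d + 0)
  eq = trans (ℤsolve (+ suc d) (+ a)) (cong (λ m → + a ℤ.* + suc m) (sym (ℕ.+-identityʳ d)))
    where
    ℤsolve : ∀ x y → (x ℤ.* y) ℤ.* + 1 ≡ y ℤ.* x
    ℤsolve = ℤsolve-∀

ℕtoℚ-∸1 : ∀ k .{{_ : NonZero k}} → ℕtoℚ (k ∸ 1) ≡ ℕtoℚ k -ℚ 1ℚ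
ℕtoℚ-∸1 (suc k) = trans (sym (cancel (ℕtoℚ k))) (cong (_-ℚ 1ℚ) (sym (ℕtoℚ-+ 1 k)))
  where
  cancel : ∀ x → 1ℚ +ℚ x -ℚ 1ℚ ≡ x
  cancel = solve-∀ ℚ-ring

frac-1-inverseˡ : ∀ D .{{_ : NonZero D}} → frac 1 D *ℚ ℕtoℚ D ≡ 1ℚ
frac-1-inverseˡ D = trans (ℚ.*-comm (frac 1 D) (ℕtoℚ D)) (ℕtoℚ-*-frac 1 D)

ℕtoℚ-*-cancelˡ : ∀ D .{{_ : NonZero D}} {q r} → ℕtoℚ D *ℚ q ≡ ℕtoℚ D *ℚ r → q ≡ r
ℕtoℚ-*-cancelˡ D {q} {r} Dq≡Dr = begin
  q                              ≡⟨ sym (ℚ.*-identityˡ q) ⟩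
  1ℚ *ℚ q                        ≡⟨ cong (_*ℚ q) (sym (frac-1-inverseˡ D)) ⟩
  frac 1 D *ℚ ℕtoℚ D *ℚ q        ≡⟨ ℚ.*-assoc (frac 1 D) (ℕtoℚ D) q ⟩
  frac 1 D *ℚ (ℕtoℚ D *ℚ q)      ≡⟨ cong (frac 1 D *ℚ_) Dq≡Dr ⟩
  frac 1 D *ℚ (ℕtoℚ D *ℚ r)      ≡⟨ ℚ.*-assoc (frac 1 D) (ℕtoℚ D) r ⟨
  frac 1 D *ℚ ℕtoℚ D *ℚ r        ≡⟨ cong (_*ℚ r) (frac-1-inverseˡ D) ⟩
  1ℚ *ℚ r                        ≡⟨ ℚ.*-identityˡ r ⟩
  r                              ∎
  where open ≡-Reasoning

frac-unique : ∀ a D .{{_ : NonZero D}} {r} → ℕtoℚ D *ℚ r ≡ ℕtoℚ a → r ≡ frac a D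
frac-unique a D Dr≡a = ℕtoℚ-*-cancelˡ D (trans Dr≡a (sym (ℕtoℚ-*-frac a D)))

frac-+-unique : ∀ a D .{{_ : NonZero D}} {r m} →
                ℕtoℚ D *ℚ r ≡ ℕtoℚ a +ℚ ℕtoℚ D *ℚ m → r ≡ frac a D +ℚ m
frac-+-unique a D {m = m} Dr≡a+Dm = ℕtoℚ-*-cancelˡ D (begin
  _                                         ≡⟨ Dr≡a+Dm ⟩
  ℕtoℚ a +ℚ ℕtoℚ D *ℚ m                     ≡⟨ cong (_+ℚ ℕtoℚ D *ℚ m) (sym (ℕtoℚ-*-frac a D)) ⟩
  ℕtoℚ D *ℚ frac a D +ℚ ℕtoℚ D *ℚ m         ≡⟨ ℚ.*-distribˡ-+ (ℕtoℚ D) (frac a D) m ⟨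
  ℕtoℚ D *ℚ (frac a D +ℚ m)                 ∎)
  where open ≡-Reasoning

sumF-cong : ∀ {n} {f g : Fin n → ℚ} → (∀ i → f i ≡ g i) → sumF f ≡ sumF g
sumF-cong {zero}  f≗g = refl
sumF-cong {suc n} f≗g = cong₂ _+ℚ_ (f≗g zero) (sumF-cong (λ i → f≗g (suc i)))

sumF-+ : ∀ {n} (f g : Fin n → ℚ) → sumF (λ i → f i +ℚ g i) ≡ sumF f +ℚ sumF g
sumF-+ {zero}  f g = refl
sumF-+ {suc n} f g = trans (cong (f zero +ℚ g zero +ℚ_) (sumF-+ (λ i → f (suc i)) (λ i → g (suc i))))
  (interchange (f zero) (g zero) _ _)
  where
  interchange : ∀ a b c d → a +ℚ b +ℚ (c +ℚ d) ≡ a +ℚ c +ℚ (b +ℚ d)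
  interchange = solve-∀ ℚ-ring

sumF-neg : ∀ {n} (f : Fin n → ℚ) → sumF (λ i → - f i) ≡ - sumF f
sumF-neg {zero}  f = refl
sumF-neg {suc n} f = trans (cong (- f zero +ℚ_) (sumF-neg (λ i → f (suc i))))
  (sym (ℚ.neg-distrib-+ (f zero) _))

sumF-- : ∀ {n} (f g : Fin n → ℚ) → sumF (λ i → f i -ℚ g i) ≡ sumF f -ℚ sumF g
sumF-- f g = trans (sumF-+ f (λ i → - g i)) (cong (sumF f +ℚ_) (sumF-neg g))

sumF-* : ∀ {n} c (f : Fin n → ℚ) → sumF (λ i → c *ℚ f i) ≡ c *ℚ sumF f
sumF-* {zero}  c f = sym (ℚ.*-zeroʳ c)
sumF-* {suc n} c f = trans (cong (c *ℚ f zero +ℚ_) (sumF-* c (λ i → f (suc i))))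
  (sym (ℚ.*-distribˡ-+ c (f zero) _))

sumF-const : ∀ n c → sumF {n} (λ _ → c) ≡ ℕtoℚ n *ℚ c
sumF-const zero    c = sym (ℚ.*-zeroˡ c)
sumF-const (suc n) c = begin
  c +ℚ sumF {n} (λ _ → c)      ≡⟨ cong (c +ℚ_) (sumF-const n c) ⟩
  c +ℚ ℕtoℚ n *ℚ c             ≡⟨ step c (ℕtoℚ n) ⟩
  (1ℚ +ℚ ℕtoℚ n) *ℚ c          ≡⟨ cong (_*ℚ c) (ℕtoℚ-+ 1 n) ⟨
  ℕtoℚ (suc n) *ℚ c            ∎
  where
  open ≡-Reasoning
  step : ∀ c m → c +ℚ m *ℚ c ≡ (1ℚ +ℚ m) *ℚ c
  step = solve-∀ ℚ-ring

sumF-zero : ∀ n → sumF {n} (λ _ → 0ℚ) ≡ 0ℚ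
sumF-zero n = trans (sumF-const n 0ℚ) (ℚ.*-zeroʳ (ℕtoℚ n))

sumF-swap : ∀ {m n} (f : Fin m → Fin n → ℚ) →
            sumF (λ i → sumF (λ j → f i j)) ≡ sumF (λ j → sumF (λ i → f i j))
sumF-swap {zero}  {n} f = sym (sumF-zero n)
sumF-swap {suc m} f = trans (cong (sumF (f zero) +ℚ_) (sumF-swap (λ i → f (suc i))))
  (sym (sumF-+ (f zero) _))

sumF-↑ : ∀ m n (f : Fin (m + n) → ℚ) → sumF f ≡ sumF (λ i → f (i ↑ˡ n)) +ℚ sumF (λ j → f (m ↑ʳ j))
sumF-↑ zero    n f = sym (ℚ.+-identityˡ _)
sumF-↑ (suc m) n f = trans (cong (f zero +ℚ_) (sumF-↑ m n (λ i → f (suc i))))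
  (sym (ℚ.+-assoc (f zero) _ _))

Id-refl : ∀ {n} (i : Fin n) → Id i i ≡ 1ℚ
Id-refl i with i ≟ i
... | yes _  = refl
... | no i≢i = contradiction refl i≢i

Id-≢ : ∀ {n} {i j : Fin n} → i ≢ j → Id i j ≡ 0ℚ
Id-≢ {i = i} {j} i≢j with i ≟ j
... | yes i≡j = contradiction i≡j i≢j
... | no _    = refl

Id-sym : ∀ {n} (i j : Fin n) → Id i j ≡ Id j i
Id-sym i j with i ≟ j
... | yes refl = sym (Id-refl i)
... | no i≢j   = sym (Id-≢ (i≢j ∘ sym))

*-Id-subst : ∀ {n} (f : Fin n → ℚ) s t → f t *ℚ Id s t ≡ f s *ℚ Id s t
*-Id-subst f s t with s ≟ t
... | yes refl = refl
... | no _     = trans (ℚ.*-zeroʳ (f t)) (sym (ℚ.*-zeroʳ (f s)))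

sumF-Idˡ : ∀ {n} (i : Fin n) (f : Fin n → ℚ) → sumF (λ l → Id i l *ℚ f l) ≡ f i
sumF-Idˡ {suc n} zero f = trans (cong₂ _+ℚ_ (ℚ.*-identityˡ (f zero))
    (trans (sumF-cong (λ l → ℚ.*-zeroˡ (f (suc l)))) (sumF-zero n)))
  (ℚ.+-identityʳ (f zero))
sumF-Idˡ {suc n} (suc i) f = trans (cong₂ _+ℚ_ (ℚ.*-zeroˡ (f zero)) (sumF-Idˡ i (λ l → f (suc l))))
  (ℚ.+-identityˡ _)

sumF-Idʳ : ∀ {n} (j : Fin n) (f : Fin n → ℚ) → sumF (λ l → f l *ℚ Id l j) ≡ f j
sumF-Idʳ j f = trans (sumF-cong (λ l → trans (ℚ.*-comm (f l) _) (cong (_*ℚ f l) (Id-sym l j))))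
  (sumF-Idˡ j f)

sumF-Id : ∀ {n} (i : Fin n) → sumF (Id i) ≡ 1ℚ
sumF-Id i = trans (sumF-cong (λ l → sym (ℚ.*-identityʳ (Id i l)))) (sumF-Idˡ i (λ _ → 1ℚ))

sumF-1-Id : ∀ {n} (s : Fin n) (y : Fin n → ℚ) → sumF (λ t → (1ℚ -ℚ Id s t) *ℚ y t) ≡ sumF y -ℚ y s
sumF-1-Id s y = begin
  sumF (λ t → (1ℚ -ℚ Id s t) *ℚ y t)            ≡⟨ sumF-cong (λ t → distrib (Id s t) (y t)) ⟩
  sumF (λ t → y t -ℚ Id s t *ℚ y t)             ≡⟨ sumF-- y (λ t → Id s t *ℚ y t) ⟩
  sumF y -ℚ sumF (λ t → Id s t *ℚ y t)          ≡⟨ cong (sumF y -ℚ_) (sumF-Idˡ s y) ⟩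
  sumF y -ℚ y s                                 ∎
  where
  open ≡-Reasoning
  distrib : ∀ i a → (1ℚ -ℚ i) *ℚ a ≡ a -ℚ i *ℚ a
  distrib = solve-∀ ℚ-ring

b2q-not-≟ : ∀ {n} (s t : Fin n) → b2q (not (does (s ≟ t))) ≡ 1ℚ -ℚ Id s t
b2q-not-≟ s t with s ≟ t
... | yes _ = refl
... | no _  = refl

-- Matrices and group inverses

_ᵀ : ∀ {n} → Mat n → Mat n
(A ᵀ) i j = A j i

Symmetric : ∀ {n} → Mat n → Set
Symmetric A = ∀ i j → A i j ≡ A j i

module ≐-Reasoning {n : ℕ} where
  ≐-setoid : Setoid _ _
  ≐-setoid = record
    { Carrier = Mat n ; _≈_ = _≐_
    ; isEquivalence = record { refl = λ _ _ → refl ; sym = λ e i j → sym (e i j)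
                             ; trans = λ e f i j → trans (e i j) (f i j) } }
  open SetoidReasoning ≐-setoid public

·-congˡ : ∀ {n} {A A′ : Mat n} (B : Mat n) → A ≐ A′ → (A · B) ≐ (A′ · B)
·-congˡ B A≐A′ i j = sumF-cong (λ l → cong (_*ℚ B l j) (A≐A′ i l))

·-congʳ : ∀ {n} (A : Mat n) {B B′ : Mat n} → B ≐ B′ → (A · B) ≐ (A · B′)
·-congʳ A B≐B′ i j = sumF-cong (λ l → cong (A i l *ℚ_) (B≐B′ l j))

ᵀ-cong : ∀ {n} {A B : Mat n} → A ≐ B → (A ᵀ) ≐ (B ᵀ)
ᵀ-cong A≐B i j = A≐B j i

·-assoc : ∀ {n} (A B C : Mat n) → ((A · B) · C) ≐ (A · (B · C))
·-assoc A B C i j = begin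
  sumF (λ l → sumF (λ m → A i m *ℚ B m l) *ℚ C l j)
    ≡⟨ sumF-cong (λ l → trans (ℚ.*-comm _ (C l j)) (trans (sym (sumF-* (C l j) (λ m → A i m *ℚ B m l)))
         (sumF-cong (λ m → rearrange (C l j) (A i m) (B m l))))) ⟩
  sumF (λ l → sumF (λ m → A i m *ℚ (B m l *ℚ C l j)))
    ≡⟨ sumF-swap (λ l m → A i m *ℚ (B m l *ℚ C l j)) ⟩
  sumF (λ m → sumF (λ l → A i m *ℚ (B m l *ℚ C l j)))
    ≡⟨ sumF-cong (λ m → sumF-* (A i m) (λ l → B m l *ℚ C l j)) ⟩
  sumF (λ m → A i m *ℚ sumF (λ l → B m l *ℚ C l j))  ∎
  where
  open ≡-Reasoning
  rearrange : ∀ c a b → c *ℚ (a *ℚ b) ≡ a *ℚ (b *ℚ c)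
  rearrange = solve-∀ ℚ-ring

ᵀ-· : ∀ {n} (A B : Mat n) → ((A · B) ᵀ) ≐ ((B ᵀ) · (A ᵀ))
ᵀ-· A B i j = sumF-cong (λ l → ℚ.*-comm (A j l) (B l i))

·-identityˡ : ∀ {n} (A : Mat n) → (Id · A) ≐ A
·-identityˡ A i j = sumF-Idˡ i (λ l → A l j)

groupInverse-unique : ∀ {n} {A X Y : Mat n} → IsGroupInverse A X → IsGroupInverse A Y → X ≐ Y
groupInverse-unique {n} {A} {X} {Y} (AXA≐A , XAX≐X , AX≐XA) (AYA≐A , YAY≐Y , AY≐YA) =
  begin
    X             ≈⟨ X≐XAY ⟩
    (X · A) · Y   ≈⟨ Y≐XAY ⟨
    Y             ∎
  where
  open ≐-Reasoning {n}
  XXA≐X : ((X · X) · A) ≐ X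
  XXA≐X = begin
    (X · X) · A   ≈⟨ ·-assoc X X A ⟩
    X · (X · A)   ≈⟨ ·-congʳ X AX≐XA ⟨
    X · (A · X)   ≈⟨ ·-assoc X A X ⟨
    (X · A) · X   ≈⟨ XAX≐X ⟩
    X             ∎
  AYY≐Y : (A · (Y · Y)) ≐ Y
  AYY≐Y = begin
    A · (Y · Y)   ≈⟨ ·-assoc A Y Y ⟨
    (A · Y) · Y   ≈⟨ ·-congˡ Y AY≐YA ⟩
    (Y · A) · Y   ≈⟨ YAY≐Y ⟩
    Y             ∎
  X≐XAY : X ≐ ((X · A) · Y)
  X≐XAY = begin
    X                         ≈⟨ XXA≐X ⟨
    (X · X) · A               ≈⟨ ·-congʳ (X · X) AYA≐A ⟨
    (X · X) · ((A · Y) · A)   ≈⟨ ·-congʳ (X · X) (·-assoc A Y A) ⟩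
    (X · X) · (A · (Y · A))   ≈⟨ ·-assoc (X · X) A (Y · A) ⟨
    ((X · X) · A) · (Y · A)   ≈⟨ ·-congˡ (Y · A) XXA≐X ⟩
    X · (Y · A)               ≈⟨ ·-congʳ X AY≐YA ⟨
    X · (A · Y)               ≈⟨ ·-assoc X A Y ⟨
    (X · A) · Y               ∎
  Y≐XAY : Y ≐ ((X · A) · Y)
  Y≐XAY = begin
    Y                         ≈⟨ AYY≐Y ⟨
    A · (Y · Y)               ≈⟨ ·-congˡ (Y · Y) AXA≐A ⟨
    ((A · X) · A) · (Y · Y)   ≈⟨ ·-assoc (A · X) A (Y · Y) ⟩
    (A · X) · (A · (Y · Y))   ≈⟨ ·-congʳ (A · X) AYY≐Y ⟩
    (A · X) · Y               ≈⟨ ·-congˡ Y AX≐XA ⟩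
    (X · A) · Y               ∎

groupInverse-ᵀ : ∀ {n} {A X : Mat n} → Symmetric A → IsGroupInverse A X → IsGroupInverse A (X ᵀ)
groupInverse-ᵀ {n} {A} {X} A≐Aᵀ (AXA≐A , XAX≐X , AX≐XA) = AXᵀA≐A , XᵀAXᵀ≐Xᵀ , AXᵀ≐XᵀA
  where
  open ≐-Reasoning {n}
  AXᵀA≐A : ((A · (X ᵀ)) · A) ≐ A
  AXᵀA≐A = begin
    (A · (X ᵀ)) · A             ≈⟨ ·-congˡ A (·-congˡ (X ᵀ) A≐Aᵀ) ⟩
    ((A ᵀ) · (X ᵀ)) · A         ≈⟨ ·-congʳ ((A ᵀ) · (X ᵀ)) A≐Aᵀ ⟩
    ((A ᵀ) · (X ᵀ)) · (A ᵀ)     ≈⟨ ·-congˡ (A ᵀ) (ᵀ-· X A) ⟨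
    ((X · A) ᵀ) · (A ᵀ)         ≈⟨ ᵀ-· A (X · A) ⟨
    (A · (X · A)) ᵀ             ≈⟨ ᵀ-cong (·-assoc A X A) ⟨
    ((A · X) · A) ᵀ             ≈⟨ ᵀ-cong AXA≐A ⟩
    A ᵀ                         ≈⟨ A≐Aᵀ ⟨
    A                           ∎
  XᵀAXᵀ≐Xᵀ : (((X ᵀ) · A) · (X ᵀ)) ≐ (X ᵀ)
  XᵀAXᵀ≐Xᵀ = begin
    ((X ᵀ) · A) · (X ᵀ)         ≈⟨ ·-congˡ (X ᵀ) (·-congʳ (X ᵀ) A≐Aᵀ) ⟩
    ((X ᵀ) · (A ᵀ)) · (X ᵀ)     ≈⟨ ·-congˡ (X ᵀ) (ᵀ-· A X) ⟨
    ((A · X) ᵀ) · (X ᵀ)         ≈⟨ ᵀ-· X (A · X) ⟨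
    (X · (A · X)) ᵀ             ≈⟨ ᵀ-cong (·-assoc X A X) ⟨
    ((X · A) · X) ᵀ             ≈⟨ ᵀ-cong XAX≐X ⟩
    X ᵀ                         ∎
  AXᵀ≐XᵀA : (A · (X ᵀ)) ≐ ((X ᵀ) · A)
  AXᵀ≐XᵀA = begin
    A · (X ᵀ)                   ≈⟨ ·-congˡ (X ᵀ) A≐Aᵀ ⟩
    (A ᵀ) · (X ᵀ)               ≈⟨ ᵀ-· X A ⟨
    (X · A) ᵀ                   ≈⟨ ᵀ-cong AX≐XA ⟨
    (A · X) ᵀ                   ≈⟨ ᵀ-· A X ⟩
    (X ᵀ) · (A ᵀ)               ≈⟨ ·-congʳ (X ᵀ) A≐Aᵀ ⟨
    (X ᵀ) · A                   ∎

groupInverse-symmetric : ∀ {n} {A X : Mat n} → Symmetric A → IsGroupInverse A X → Symmetric X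
groupInverse-symmetric A≐Aᵀ gi = groupInverse-unique gi (groupInverse-ᵀ A≐Aᵀ gi)

inverse⇒groupInverse : ∀ {n} {A M : Mat n} → IsInverse A M → IsGroupInverse A M
inverse⇒groupInverse {n} {A} {M} (AM≐I , MA≐I) = AMA≐A , MAM≐M , AM≐MA
  where
  open ≐-Reasoning {n}
  AMA≐A : ((A · M) · A) ≐ A
  AMA≐A = begin (A · M) · A ≈⟨ ·-congˡ A AM≐I ⟩ Id · A ≈⟨ ·-identityˡ A ⟩ A ∎
  MAM≐M : ((M · A) · M) ≐ M
  MAM≐M = begin (M · A) · M ≈⟨ ·-congˡ M MA≐I ⟩ Id · M ≈⟨ ·-identityˡ M ⟩ M ∎
  AM≐MA : (A · M) ≐ (M · A)
  AM≐MA = begin A · M ≈⟨ AM≐I ⟩ Id ≈⟨ MA≐I ⟨ M · A ∎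

-- Vectors and potentials

Vector : ℕ → Set
Vector n = Fin n → ℚ

e : ∀ {n} → Fin n → Vector n
e = Id

infixl 6 _⊕_ _⊖_
infixl 7 _⊛_
infixr 8 _▹_

_⊕_ _⊖_ : ∀ {n} → Vector n → Vector n → Vector n
(u ⊕ v) i = u i +ℚ v i
(u ⊖ v) i = u i -ℚ v i

_⊛_ : ∀ {n} → ℚ → Vector n → Vector n
(c ⊛ v) i = c *ℚ v i

_▹_ : ∀ {n} → Mat n → Vector n → Vector n
(A ▹ v) i = sumF (λ l → A i l *ℚ v l)

dot : ∀ {n} → Vector n → Vector n → ℚ
dot u v = sumF (λ i → u i *ℚ v i)

▹-cong : ∀ {n} (A : Mat n) {u v : Vector n} → u ≗ v → A ▹ u ≗ A ▹ v
▹-cong A u≗v i = sumF-cong (λ l → cong (A i l *ℚ_) (u≗v l))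

▹-⊕ : ∀ {n} {A : Mat n} {u u′ v v′} → A ▹ u ≗ u′ → A ▹ v ≗ v′ → A ▹ (u ⊕ v) ≗ u′ ⊕ v′
▹-⊕ {A = A} {u} {v = v} Au≗u′ Av≗v′ i =
  trans (trans (sumF-cong (λ l → ℚ.*-distribˡ-+ (A i l) (u l) (v l)))
          (sumF-+ (λ l → A i l *ℚ u l) (λ l → A i l *ℚ v l)))
        (cong₂ _+ℚ_ (Au≗u′ i) (Av≗v′ i))

▹-⊛ : ∀ {n} {A : Mat n} {v v′} c → A ▹ v ≗ v′ → A ▹ (c ⊛ v) ≗ c ⊛ v′
▹-⊛ {A = A} {v} c Av≗v′ i =
  trans (trans (sumF-cong (λ l → swap (A i l) c (v l))) (sumF-* c (λ l → A i l *ℚ v l))) (cong (c *ℚ_) (Av≗v′ i))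
  where
  swap : ∀ a c x → a *ℚ (c *ℚ x) ≡ c *ℚ (a *ℚ x)
  swap = solve-∀ ℚ-ring

▹-⊖ : ∀ {n} {A : Mat n} {u u′ v v′} → A ▹ u ≗ u′ → A ▹ v ≗ v′ → A ▹ (u ⊖ v) ≗ u′ ⊖ v′
▹-⊖ {A = A} {u} {v = v} Au≗u′ Av≗v′ i =
  trans (trans (sumF-cong (λ l → distrib (A i l) (u l) (v l)))
          (sumF-- (λ l → A i l *ℚ u l) (λ l → A i l *ℚ v l)))
        (cong₂ _-ℚ_ (Au≗u′ i) (Av≗v′ i))
  where
  distrib : ∀ a x y → a *ℚ (x -ℚ y) ≡ a *ℚ x -ℚ a *ℚ y
  distrib = solve-∀ ℚ-ring

▹-· : ∀ {n} (A B : Mat n) (v : Vector n) → (A · B) ▹ v ≗ A ▹ B ▹ v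
▹-· A B v i = begin
  sumF (λ l → sumF (λ m → A i m *ℚ B m l) *ℚ v l)
    ≡⟨ sumF-cong (λ l → trans (ℚ.*-comm _ (v l)) (trans (sym (sumF-* (v l) (λ m → A i m *ℚ B m l)))
         (sumF-cong (λ m → rearrange (v l) (A i m) (B m l))))) ⟩
  sumF (λ l → sumF (λ m → A i m *ℚ (B m l *ℚ v l)))
    ≡⟨ sumF-swap (λ l m → A i m *ℚ (B m l *ℚ v l)) ⟩
  sumF (λ m → sumF (λ l → A i m *ℚ (B m l *ℚ v l)))
    ≡⟨ sumF-cong (λ m → sumF-* (A i m) (λ l → B m l *ℚ v l)) ⟩
  sumF (λ m → A i m *ℚ sumF (λ l → B m l *ℚ v l))  ∎
  where
  open ≡-Reasoning
  rearrange : ∀ c a b → c *ℚ (a *ℚ b) ≡ a *ℚ (b *ℚ c)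
  rearrange = solve-∀ ℚ-ring

dot-comm : ∀ {n} (u v : Vector n) → dot u v ≡ dot v u
dot-comm u v = sumF-cong (λ i → ℚ.*-comm (u i) (v i))

dot-▹ : ∀ {n} {A : Mat n} → Symmetric A → ∀ u v → dot (A ▹ u) v ≡ dot u (A ▹ v)
dot-▹ {A = A} A≐Aᵀ u v = begin
  sumF (λ i → sumF (λ l → A i l *ℚ u l) *ℚ v i)
    ≡⟨ sumF-cong (λ i → trans (ℚ.*-comm _ (v i)) (sym (sumF-* (v i) (λ l → A i l *ℚ u l)))) ⟩
  sumF (λ i → sumF (λ l → v i *ℚ (A i l *ℚ u l)))
    ≡⟨ sumF-swap (λ i l → v i *ℚ (A i l *ℚ u l)) ⟩
  sumF (λ l → sumF (λ i → v i *ℚ (A i l *ℚ u l)))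
    ≡⟨ sumF-cong (λ l → trans (sumF-cong (λ i → trans (rearrange (v i) (A i l) (u l))
           (cong (λ a → u l *ℚ (a *ℚ v i)) (A≐Aᵀ i l))))
         (sumF-* (u l) (λ i → A l i *ℚ v i))) ⟩
  sumF (λ l → u l *ℚ sumF (λ i → A l i *ℚ v i))  ∎
  where
  open ≡-Reasoning
  rearrange : ∀ x a y → x *ℚ (a *ℚ y) ≡ y *ℚ (a *ℚ x)
  rearrange = solve-∀ ℚ-ring

dot-e⊖e : ∀ {n} (f : Vector n) u v → dot f (e u ⊖ e v) ≡ f u -ℚ f v
dot-e⊖e f u v = begin
  sumF (λ l → f l *ℚ (Id u l -ℚ Id v l))
    ≡⟨ sumF-cong (λ l → distrib (f l) (Id u l) (Id v l)) ⟩
  sumF (λ l → Id u l *ℚ f l -ℚ Id v l *ℚ f l)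
    ≡⟨ sumF-- (λ l → Id u l *ℚ f l) (λ l → Id v l *ℚ f l) ⟩
  sumF (λ l → Id u l *ℚ f l) -ℚ sumF (λ l → Id v l *ℚ f l)
    ≡⟨ cong₂ _-ℚ_ (sumF-Idˡ u f) (sumF-Idˡ v f) ⟩
  f u -ℚ f v  ∎
  where
  open ≡-Reasoning
  distrib : ∀ x a b → x *ℚ (a -ℚ b) ≡ a *ℚ x -ℚ b *ℚ x
  distrib = solve-∀ ℚ-ring

potential⇒resistance : ∀ {n} {L X : Mat n} → Symmetric L → IsGroupInverse L X →
                       ∀ {z : Vector n} {u v} → L ▹ z ≗ e u ⊖ e v →
                       resistance X u v ≡ z u -ℚ z v
potential⇒resistance {L = L} {X} L≐Lᵀ gi@(LXL≐L , _) {z} {u} {v} Lz≗b = begin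
  X u u +ℚ X v v -ℚ ℕtoℚ 2 *ℚ X u v
    ≡⟨ regroup (X u u) (X v v) (X u v) ⟩
  (X u u -ℚ X u v) -ℚ (X u v -ℚ X v v)
    ≡⟨ cong (λ x → (X u u -ℚ X u v) -ℚ (x -ℚ X v v)) (groupInverse-symmetric L≐Lᵀ gi u v) ⟩
  (X u u -ℚ X u v) -ℚ (X v u -ℚ X v v)
    ≡⟨ cong₂ _-ℚ_ (dot-e⊖e (X u) u v) (dot-e⊖e (X v) u v) ⟨
  w u -ℚ w v
    ≡⟨ trans (dot-comm b w) (dot-e⊖e w u v) ⟨
  dot b w
    ≡⟨ sumF-cong (λ l → cong (_*ℚ w l) (Lz≗b l)) ⟨
  dot (L ▹ z) w
    ≡⟨ dot-▹ L≐Lᵀ z w ⟩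
  dot z (L ▹ w)
    ≡⟨ sumF-cong (λ l → cong (z l *ℚ_) (Lw≗b l)) ⟩
  dot z b
    ≡⟨ dot-e⊖e z u v ⟩
  z u -ℚ z v  ∎
  where
  open ≡-Reasoning
  b = e u ⊖ e v
  w = X ▹ b
  regroup : ∀ a c x → a +ℚ c -ℚ ℕtoℚ 2 *ℚ x ≡ (a -ℚ x) -ℚ (x -ℚ c)
  regroup = solve-∀ ℚ-ring
  Lw≗b : L ▹ w ≗ b
  Lw≗b l = begin
    (L ▹ X ▹ b) l          ≡⟨ ▹-cong L (▹-cong X (λ i → sym (Lz≗b i))) l ⟩
    (L ▹ X ▹ L ▹ z) l      ≡⟨ ▹-cong L (λ i → sym (▹-· X L z i)) l ⟩
    (L ▹ (X · L) ▹ z) l    ≡⟨ sym (▹-· L (X · L) z l) ⟩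
    ((L · (X · L)) ▹ z) l  ≡⟨ sumF-cong (λ m → cong (_*ℚ z m) (trans (sym (·-assoc L X L l m)) (LXL≐L l m))) ⟩
    (L ▹ z) l              ≡⟨ Lz≗b l ⟩
    b l                    ∎

scaledPotential⇒resistance : ∀ {n} {L X : Mat n} → Symmetric L → IsGroupInverse L X →
                             ∀ D .{{_ : NonZero D}} {c} → ℕtoℚ D ≡ c → ∀ {z : Vector n} {u v} →
                             L ▹ z ≗ c ⊛ (e u ⊖ e v) →
                             ℕtoℚ D *ℚ resistance X u v ≡ z u -ℚ z v
scaledPotential⇒resistance {L = L} {X} L≐Lᵀ gi D {c} D≡c {z} {u} {v} Lz≗cb = begin
  ℕtoℚ D *ℚ resistance X u v                        ≡⟨ cong (ℕtoℚ D *ℚ_) r≡z′u-z′v ⟩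
  ℕtoℚ D *ℚ (frac 1 D *ℚ z u -ℚ frac 1 D *ℚ z v)   ≡⟨ factor (ℕtoℚ D) (frac 1 D) (z u) (z v) ⟩
  frac 1 D *ℚ ℕtoℚ D *ℚ (z u -ℚ z v)               ≡⟨ cong (_*ℚ (z u -ℚ z v)) (frac-1-inverseˡ D) ⟩
  1ℚ *ℚ (z u -ℚ z v)                               ≡⟨ ℚ.*-identityˡ _ ⟩
  z u -ℚ z v                                       ∎
  where
  open ≡-Reasoning
  factor : ∀ d d′ x y → d *ℚ (d′ *ℚ x -ℚ d′ *ℚ y) ≡ d′ *ℚ d *ℚ (x -ℚ y)
  factor = solve-∀ ℚ-ring
  r≡z′u-z′v : resistance X u v ≡ frac 1 D *ℚ z u -ℚ frac 1 D *ℚ z v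
  r≡z′u-z′v = potential⇒resistance L≐Lᵀ gi {z = frac 1 D ⊛ z} (λ l → begin
    (L ▹ (frac 1 D ⊛ z)) l                ≡⟨ ▹-⊛ {A = L} (frac 1 D) Lz≗cb l ⟩
    frac 1 D *ℚ (c *ℚ (e u ⊖ e v) l)      ≡⟨ cong (λ d → frac 1 D *ℚ (d *ℚ _)) D≡c ⟨
    frac 1 D *ℚ (ℕtoℚ D *ℚ (e u ⊖ e v) l) ≡⟨ ℚ.*-assoc (frac 1 D) (ℕtoℚ D) _ ⟨
    frac 1 D *ℚ ℕtoℚ D *ℚ (e u ⊖ e v) l   ≡⟨ cong (_*ℚ _) (frac-1-inverseˡ D) ⟩
    1ℚ *ℚ (e u ⊖ e v) l                   ≡⟨ ℚ.*-identityˡ _ ⟩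
    (e u ⊖ e v) l                         ∎)

e⊖e-gap : ∀ {m} {u v : Fin m} → u ≢ v → (e u ⊖ e v) u -ℚ (e u ⊖ e v) v ≡ ℕtoℚ 2
e⊖e-gap {u = u} {v} u≢v rewrite Id-refl u | Id-refl v | Id-≢ u≢v | Id-≢ (u≢v ∘ sym) = refl

twins⇒resistance : ∀ {n} {L X : Mat n} → Symmetric L → IsGroupInverse L X →
                   ∀ D .{{_ : NonZero D}} {c} → ℕtoℚ D ≡ c → ∀ {f : Vector n} {u v} → u ≢ v →
                   L ▹ e u ≗ c ⊛ e u ⊖ f → L ▹ e v ≗ c ⊛ e v ⊖ f →
                   ℕtoℚ D *ℚ resistance X u v ≡ ℕtoℚ 2
twins⇒resistance {L = L} L≐Lᵀ gi D {c} D≡c {f} {u} {v} u≢v Leu Lev =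
  trans (scaledPotential⇒resistance L≐Lᵀ gi D D≡c {z = e u ⊖ e v}
          (λ w → trans (▹-⊖ {A = L} Leu Lev w) (arith c (e u w) (e v w) (f w))))
        (e⊖e-gap u≢v)
  where
  arith : ∀ c x y f → (c *ℚ x -ℚ f) -ℚ (c *ℚ y -ℚ f) ≡ c *ℚ (x -ℚ y)
  arith = solve-∀ ℚ-ring

if-Id : ∀ {n} (u v : Fin n) d → (if does (u ≟ v) then d else 0ℚ) ≡ d *ℚ Id u v
if-Id u v d with u ≟ v
... | yes _ = sym (ℚ.*-identityʳ d)
... | no _  = sym (ℚ.*-zeroʳ d)

Laplacian-▹ : ∀ {n} (H : Graph n) (z : Vector n) u →
              (Laplacian H ▹ z) u ≡ degree H u *ℚ z u -ℚ sumF (λ v → b2q (H u v) *ℚ z v)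
Laplacian-▹ H z u = begin
  sumF (λ v → ((if does (u ≟ v) then degree H u else 0ℚ) -ℚ b2q (H u v)) *ℚ z v)
    ≡⟨ sumF-cong (λ v → trans (cong (λ d → (d -ℚ b2q (H u v)) *ℚ z v) (if-Id u v (degree H u)))
         (distrib (degree H u) (Id u v) (b2q (H u v)) (z v))) ⟩
  sumF (λ v → Id u v *ℚ (degree H u *ℚ z v) -ℚ b2q (H u v) *ℚ z v)
    ≡⟨ sumF-- (λ v → Id u v *ℚ (degree H u *ℚ z v)) (λ v → b2q (H u v) *ℚ z v) ⟩
  sumF (λ v → Id u v *ℚ (degree H u *ℚ z v)) -ℚ sumF (λ v → b2q (H u v) *ℚ z v)
    ≡⟨ cong (_-ℚ sumF (λ v → b2q (H u v) *ℚ z v)) (sumF-Idˡ u (λ v → degree H u *ℚ z v)) ⟩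
  degree H u *ℚ z u -ℚ sumF (λ v → b2q (H u v) *ℚ z v)  ∎
  where
  open ≡-Reasoning
  distrib : ∀ d i a x → (d *ℚ i -ℚ a) *ℚ x ≡ i *ℚ (d *ℚ x) -ℚ a *ℚ x
  distrib = solve-∀ ℚ-ring

Laplacian-▹-const : ∀ {n} (H : Graph n) c → Laplacian H ▹ (λ _ → c) ≗ λ _ → 0ℚ
Laplacian-▹-const H c u = begin
  (Laplacian H ▹ (λ _ → c)) u
    ≡⟨ Laplacian-▹ H (λ _ → c) u ⟩
  degree H u *ℚ c -ℚ sumF (λ v → b2q (H u v) *ℚ c)
    ≡⟨ cong (degree H u *ℚ c -ℚ_) (trans (sumF-cong (λ v → ℚ.*-comm (b2q (H u v)) c))
         (trans (sumF-* c (λ v → b2q (H u v))) (ℚ.*-comm c (degree H u)))) ⟩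
  degree H u *ℚ c -ℚ degree H u *ℚ c
    ≡⟨ ℚ.+-inverseʳ (degree H u *ℚ c) ⟩
  0ℚ  ∎
  where open ≡-Reasoning

Laplacian-symmetric : ∀ {n} {H : Graph n} → (∀ u v → H u v ≡ H v u) → Symmetric (Laplacian H)
Laplacian-symmetric {H = H} H-sym u v = cong₂ _-ℚ_ diagonal (cong b2q (H-sym u v))
  where
  diagonal : (if does (u ≟ v) then degree H u else 0ℚ) ≡ (if does (v ≟ u) then degree H v else 0ℚ)
  diagonal with u ≟ v | v ≟ u
  ... | yes refl | yes _   = refl
  ... | yes u≡v  | no v≢u  = contradiction (sym u≡v) v≢u
  ... | no u≢v   | yes v≡u = contradiction (sym v≡u) u≢v
  ... | no _     | no _    = refl

shiftDiag-▹ : ∀ {n} (B : Mat n) k (x : Vector n) → shiftDiag B k ▹ x ≗ B ▹ x ⊕ ℕtoℚ k ⊛ x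
shiftDiag-▹ B k x a = begin
  sumF (λ b → (B a b +ℚ ℕtoℚ k *ℚ Id a b) *ℚ x b)
    ≡⟨ sumF-cong (λ b → distrib (B a b) (ℕtoℚ k) (Id a b) (x b)) ⟩
  sumF (λ b → B a b *ℚ x b +ℚ Id a b *ℚ (ℕtoℚ k *ℚ x b))
    ≡⟨ sumF-+ (λ b → B a b *ℚ x b) (λ b → Id a b *ℚ (ℕtoℚ k *ℚ x b)) ⟩
  (B ▹ x) a +ℚ sumF (λ b → Id a b *ℚ (ℕtoℚ k *ℚ x b))
    ≡⟨ cong ((B ▹ x) a +ℚ_) (sumF-Idˡ a (λ b → ℕtoℚ k *ℚ x b)) ⟩
  (B ▹ x) a +ℚ ℕtoℚ k *ℚ x a  ∎
  where
  open ≡-Reasoning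
  distrib : ∀ m c i y → (m +ℚ c *ℚ i) *ℚ y ≡ m *ℚ y +ℚ i *ℚ (c *ℚ y)
  distrib = solve-∀ ℚ-ring

shiftDiag-symmetric : ∀ {n} {B : Mat n} k → Symmetric B → Symmetric (shiftDiag B k)
shiftDiag-symmetric k B-sym u v = cong₂ _+ℚ_ (B-sym u v) (cong (ℕtoℚ k *ℚ_) (Id-sym u v))

-- The graph K_p ∘_k (G_n ∨ K_k)

↑-elim : ∀ {m n} (P : Fin (m + n) → Set) → (∀ i → P (i ↑ˡ n)) → (∀ j → P (m ↑ʳ j)) → ∀ w → P w
↑-elim {m} P left right w with splitAt m w in eq
... | inj₁ i = subst P (splitAt⁻¹-↑ˡ eq) (left i)
... | inj₂ j = subst P (splitAt⁻¹-↑ʳ eq) (right j)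

↑ˡ≢↑ʳ : ∀ {m n} (i : Fin m) (j : Fin n) → i ↑ˡ n ≢ m ↑ʳ j
↑ˡ≢↑ʳ {m} {n} i j eq with trans (sym (splitAt-↑ˡ m i n)) (trans (cong (splitAt m) eq) (splitAt-↑ʳ m n j))
... | ()

Id-↑ˡ↑ˡ : ∀ {m n} (i j : Fin m) → Id (i ↑ˡ n) (j ↑ˡ n) ≡ Id i j
Id-↑ˡ↑ˡ {n = n} i j with i ≟ j
... | yes refl = Id-refl (i ↑ˡ n)
... | no i≢j   = Id-≢ (i≢j ∘ ↑ˡ-injective n i j)

Id-↑ʳ↑ʳ : ∀ {m n} (i j : Fin n) → Id (m ↑ʳ i) (m ↑ʳ j) ≡ Id i j
Id-↑ʳ↑ʳ {m} i j with i ≟ j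
... | yes refl = Id-refl (m ↑ʳ i)
... | no i≢j   = Id-≢ (i≢j ∘ ↑ʳ-injective m i j)

Id-↑ˡ↑ʳ : ∀ {m n} (i : Fin m) (j : Fin n) → Id (i ↑ˡ n) (m ↑ʳ j) ≡ 0ℚ
Id-↑ˡ↑ʳ i j = Id-≢ (↑ˡ≢↑ʳ i j)

Id-↑ʳ↑ˡ : ∀ {m n} (j : Fin n) (i : Fin m) → Id (m ↑ʳ j) (i ↑ˡ n) ≡ 0ℚ
Id-↑ʳ↑ˡ j i = Id-≢ (↑ˡ≢↑ʳ i j ∘ sym)

χ< : ∀ {p} → ℕ → Fin p → ℚ
χ< k t = b2q (does (suc (toℕ t) ℕ.≤? k))

χ<-< : ∀ {p} {k} {t : Fin p} → toℕ t < k → χ< k t ≡ 1ℚ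
χ<-< {k = k} {t} t<k rewrite dec-true (suc (toℕ t) ℕ.≤? k) t<k = refl

χ<-≥ : ∀ {p} {k} {t : Fin p} → k ≤ toℕ t → χ< k t ≡ 0ℚ
χ<-≥ {k = k} {t} k≤t rewrite dec-false (suc (toℕ t) ℕ.≤? k) (λ t<k → ℕ.<⇒≱ t<k k≤t) = refl

χ<-idem : ∀ {p} k (t : Fin p) → χ< k t *ℚ χ< k t ≡ χ< k t
χ<-idem k t with does (suc (toℕ t) ℕ.≤? k)
... | true  = refl
... | false = refl

sumF-χ< : ∀ p k → k ≤ p → sumF {p} (χ< k) ≡ ℕtoℚ k
sumF-χ< zero    zero    z≤n       = refl
sumF-χ< (suc p) zero    z≤n       = trans (ℚ.+-identityˡ _) (sumF-zero p)
sumF-χ< (suc p) (suc k) (s≤s k≤p) = trans (cong (1ℚ +ℚ_) (sumF-χ< p k k≤p)) (sym (ℕtoℚ-+ 1 k))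

module Join (n k p : ℕ) (k≤p : k ≤ p) (G : Graph n) where

  H : Graph (n + p)
  H = composite n k p G

  L : Mat (n + p)
  L = Laplacian H

  LG+kI : Mat n
  LG+kI = shiftDiag (Laplacian G) k

  χ : Fin p → ℚ
  χ = χ< k

  K N P : ℚ
  K = ℕtoℚ k
  N = ℕtoℚ n
  P = ℕtoℚ p

  glue : Vector n → Vector p → Vector (n + p)
  glue x y = [ x , y ]′ ∘ splitAt n

  glue-↑ˡ : ∀ x y a → glue x y (a ↑ˡ p) ≡ x a
  glue-↑ˡ x y a rewrite splitAt-↑ˡ n a p = refl

  glue-↑ʳ : ∀ x y t → glue x y (n ↑ʳ t) ≡ y t
  glue-↑ʳ x y t rewrite splitAt-↑ʳ n p t = refl

  H-↑ˡ↑ˡ : ∀ a b → H (a ↑ˡ p) (b ↑ˡ p) ≡ G a b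
  H-↑ˡ↑ˡ a b rewrite splitAt-↑ˡ n a p | splitAt-↑ˡ n b p = refl

  H-↑ˡ↑ʳ : ∀ a t → H (a ↑ˡ p) (n ↑ʳ t) ≡ does (suc (toℕ t) ℕ.≤? k)
  H-↑ˡ↑ʳ a t rewrite splitAt-↑ˡ n a p | splitAt-↑ʳ n p t = refl

  H-↑ʳ↑ˡ : ∀ s b → H (n ↑ʳ s) (b ↑ˡ p) ≡ does (suc (toℕ s) ℕ.≤? k)
  H-↑ʳ↑ˡ s b rewrite splitAt-↑ʳ n p s | splitAt-↑ˡ n b p = refl

  H-↑ʳ↑ʳ : ∀ s t → H (n ↑ʳ s) (n ↑ʳ t) ≡ not (does (s ≟ t))
  H-↑ʳ↑ʳ s t rewrite splitAt-↑ʳ n p s | splitAt-↑ʳ n p t = refl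

  H-sym : (∀ a b → G a b ≡ G b a) → ∀ u v → H u v ≡ H v u
  H-sym G-sym = ↑-elim _
    (λ a → ↑-elim _
      (λ b → trans (H-↑ˡ↑ˡ a b) (trans (G-sym a b) (sym (H-↑ˡ↑ˡ b a))))
      (λ t → trans (H-↑ˡ↑ʳ a t) (sym (H-↑ʳ↑ˡ t a))))
    (λ s → ↑-elim _
      (λ b → trans (H-↑ʳ↑ˡ s b) (sym (H-↑ˡ↑ʳ b s)))
      (λ t → trans (H-↑ʳ↑ʳ s t) (trans (cong not (does-sym s t)) (sym (H-↑ʳ↑ʳ t s)))))
    where
    does-sym : (s t : Fin p) → does (s ≟ t) ≡ does (t ≟ s)
    does-sym s t with s ≟ t | t ≟ s
    ... | yes _   | yes _   = refl
    ... | no _    | no _    = refl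
    ... | yes s≡t | no t≢s  = contradiction (sym s≡t) t≢s
    ... | no s≢t  | yes t≡s = contradiction (sym t≡s) s≢t

  degree-↑ˡ : ∀ a → degree H (a ↑ˡ p) ≡ degree G a +ℚ K
  degree-↑ˡ a = trans (sumF-↑ n p (λ v → b2q (H (a ↑ˡ p) v)))
    (cong₂ _+ℚ_ (sumF-cong (λ b → cong b2q (H-↑ˡ↑ˡ a b)))
                (trans (sumF-cong (λ t → cong b2q (H-↑ˡ↑ʳ a t))) (sumF-χ< p k k≤p)))

  degree-↑ʳ : ∀ s → degree H (n ↑ʳ s) ≡ N *ℚ χ s +ℚ (P -ℚ 1ℚ)
  degree-↑ʳ s = trans (sumF-↑ n p (λ v → b2q (H (n ↑ʳ s) v)))
    (cong₂ _+ℚ_ (trans (sumF-cong (λ b → cong b2q (H-↑ʳ↑ˡ s b))) (sumF-const n (χ s)))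
                (begin
      sumF (λ t → b2q (H (n ↑ʳ s) (n ↑ʳ t)))        ≡⟨ sumF-cong (λ t → trans (cong b2q (H-↑ʳ↑ʳ s t))
                                                         (trans (b2q-not-≟ s t) (sym (ℚ.*-identityʳ _)))) ⟩
      sumF (λ t → (1ℚ -ℚ Id s t) *ℚ 1ℚ)              ≡⟨ sumF-1-Id s (λ _ → 1ℚ) ⟩
      sumF {p} (λ _ → 1ℚ) -ℚ 1ℚ                      ≡⟨ cong (_-ℚ 1ℚ) (trans (sumF-const p 1ℚ) (ℚ.*-identityʳ P)) ⟩
      P -ℚ 1ℚ                                         ∎))
    where open ≡-Reasoning

  L▹glue-↑ˡ : ∀ (x : Vector n) (y : Vector p) a →
              (L ▹ glue x y) (a ↑ˡ p) ≡ (LG+kI ▹ x) a -ℚ sumF (λ t → χ t *ℚ y t)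
  L▹glue-↑ˡ x y a = begin
    (L ▹ glue x y) (a ↑ˡ p)
      ≡⟨ Laplacian-▹ H (glue x y) (a ↑ˡ p) ⟩
    degree H (a ↑ˡ p) *ℚ glue x y (a ↑ˡ p) -ℚ sumF (λ v → b2q (H (a ↑ˡ p) v) *ℚ glue x y v)
      ≡⟨ cong₂ _-ℚ_ (cong₂ _*ℚ_ (degree-↑ˡ a) (glue-↑ˡ x y a))
           (trans (sumF-↑ n p (λ v → b2q (H (a ↑ˡ p) v) *ℚ glue x y v)) (cong₂ _+ℚ_
              (sumF-cong (λ b → cong₂ (λ g z → b2q g *ℚ z) (H-↑ˡ↑ˡ a b) (glue-↑ˡ x y b)))
              (sumF-cong (λ t → cong₂ (λ g z → b2q g *ℚ z) (H-↑ˡ↑ʳ a t) (glue-↑ʳ x y t))))) ⟩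
    (degree G a +ℚ K) *ℚ x a -ℚ (sumF (λ b → b2q (G a b) *ℚ x b) +ℚ sumF (λ t → χ t *ℚ y t))
      ≡⟨ regroup (degree G a) K (x a) _ _ ⟩
    (degree G a *ℚ x a -ℚ sumF (λ b → b2q (G a b) *ℚ x b)) +ℚ K *ℚ x a -ℚ sumF (λ t → χ t *ℚ y t)
      ≡⟨ cong (λ g → g +ℚ K *ℚ x a -ℚ sumF (λ t → χ t *ℚ y t)) (Laplacian-▹ G x a) ⟨
    (Laplacian G ▹ x) a +ℚ K *ℚ x a -ℚ sumF (λ t → χ t *ℚ y t)
      ≡⟨ cong (_-ℚ sumF (λ t → χ t *ℚ y t)) (shiftDiag-▹ (Laplacian G) k x a) ⟨
    (LG+kI ▹ x) a -ℚ sumF (λ t → χ t *ℚ y t)  ∎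
    where
    open ≡-Reasoning
    regroup : ∀ d c z s₁ s₂ → (d +ℚ c) *ℚ z -ℚ (s₁ +ℚ s₂) ≡ (d *ℚ z -ℚ s₁) +ℚ c *ℚ z -ℚ s₂
    regroup = solve-∀ ℚ-ring

  L▹glue-↑ʳ : ∀ (x : Vector n) (y : Vector p) s →
              (L ▹ glue x y) (n ↑ʳ s) ≡ (P +ℚ N *ℚ χ s) *ℚ y s -ℚ χ s *ℚ sumF x -ℚ sumF y
  L▹glue-↑ʳ x y s = begin
    (L ▹ glue x y) (n ↑ʳ s)
      ≡⟨ Laplacian-▹ H (glue x y) (n ↑ʳ s) ⟩
    degree H (n ↑ʳ s) *ℚ glue x y (n ↑ʳ s) -ℚ sumF (λ v → b2q (H (n ↑ʳ s) v) *ℚ glue x y v)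
      ≡⟨ cong₂ _-ℚ_ (cong₂ _*ℚ_ (degree-↑ʳ s) (glue-↑ʳ x y s))
           (trans (sumF-↑ n p (λ v → b2q (H (n ↑ʳ s) v) *ℚ glue x y v)) (cong₂ _+ℚ_
              (trans (sumF-cong (λ b → cong₂ (λ g z → b2q g *ℚ z) (H-↑ʳ↑ˡ s b) (glue-↑ˡ x y b)))
                     (sumF-* (χ s) x))
              (trans (sumF-cong (λ t → cong₂ _*ℚ_ (trans (cong b2q (H-↑ʳ↑ʳ s t)) (b2q-not-≟ s t))
                                                   (glue-↑ʳ x y t)))
                     (sumF-1-Id s y)))) ⟩
    (N *ℚ χ s +ℚ (P -ℚ 1ℚ)) *ℚ y s -ℚ (χ s *ℚ sumF x +ℚ (sumF y -ℚ y s))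
      ≡⟨ regroup N (χ s) P (y s) (sumF x) (sumF y) ⟩
    (P +ℚ N *ℚ χ s) *ℚ y s -ℚ χ s *ℚ sumF x -ℚ sumF y  ∎
    where
    open ≡-Reasoning
    regroup : ∀ N c P z σx σy → (N *ℚ c +ℚ (P -ℚ 1ℚ)) *ℚ z -ℚ (c *ℚ σx +ℚ (σy -ℚ z))
                                ≡ (P +ℚ N *ℚ c) *ℚ z -ℚ c *ℚ σx -ℚ σy
    regroup = solve-∀ ℚ-ring

  ≗-blocks : ∀ {f g : Vector (n + p)} → (∀ a → f (a ↑ˡ p) ≡ g (a ↑ˡ p)) →
             (∀ t → f (n ↑ʳ t) ≡ g (n ↑ʳ t)) → f ≗ g
  ≗-blocks {f} {g} = ↑-elim (λ w → f w ≡ g w)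

  𝟙G 𝟙K χT : Vector (n + p)
  𝟙G = glue (λ _ → 1ℚ) (λ _ → 0ℚ)
  𝟙K = glue (λ _ → 0ℚ) (λ _ → 1ℚ)
  χT = glue (λ _ → 0ℚ) χ

  e-↑ʳ : ∀ s → e (n ↑ʳ s) ≗ glue (λ _ → 0ℚ) (e s)
  e-↑ʳ s = ≗-blocks (λ a → trans (Id-↑ʳ↑ˡ {n} s a) (sym (glue-↑ˡ (λ _ → 0ℚ) (e s) a)))
                    (λ t → trans (Id-↑ʳ↑ʳ {n} s t) (sym (glue-↑ʳ (λ _ → 0ℚ) (e s) t)))

  LG+kI▹const : ∀ c → LG+kI ▹ (λ _ → c) ≗ λ _ → K *ℚ c
  LG+kI▹const c a = trans (shiftDiag-▹ (Laplacian G) k (λ _ → c) a)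
    (trans (cong (_+ℚ K *ℚ c) (Laplacian-▹-const G c a)) (ℚ.+-identityˡ (K *ℚ c)))

  L▹glue : ∀ x y {r : Vector (n + p)} →
           (∀ a → (LG+kI ▹ x) a -ℚ sumF (λ t → χ t *ℚ y t) ≡ r (a ↑ˡ p)) →
           (∀ s → (P +ℚ N *ℚ χ s) *ℚ y s -ℚ χ s *ℚ sumF x -ℚ sumF y ≡ r (n ↑ʳ s)) →
           L ▹ glue x y ≗ r
  L▹glue x y row-G row-K = ≗-blocks (λ a → trans (L▹glue-↑ˡ x y a) (row-G a))
                                    (λ s → trans (L▹glue-↑ʳ x y s) (row-K s))

  sumF-χ*0 : sumF (λ t → χ t *ℚ 0ℚ) ≡ 0ℚ
  sumF-χ*0 = trans (sumF-cong (λ t → ℚ.*-zeroʳ (χ t))) (sumF-zero p)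

  L▹e-↑ʳ : ∀ s → L ▹ e (n ↑ʳ s) ≗ (P +ℚ N *ℚ χ s) ⊛ e (n ↑ʳ s) ⊖ 𝟙K ⊖ χ s ⊛ 𝟙G
  L▹e-↑ʳ s w = trans (▹-cong L (e-↑ʳ s) w) (L▹glue (λ _ → 0ℚ) (e s) row-G row-K w)
    where
    row-G : ∀ a → (LG+kI ▹ (λ _ → 0ℚ)) a -ℚ sumF (λ t → χ t *ℚ Id s t)
                  ≡ ((P +ℚ N *ℚ χ s) ⊛ e (n ↑ʳ s) ⊖ 𝟙K ⊖ χ s ⊛ 𝟙G) (a ↑ˡ p)
    row-G a = trans (cong₂ _-ℚ_ (LG+kI▹const 0ℚ a)
                      (trans (sumF-cong (λ t → cong (χ t *ℚ_) (Id-sym s t))) (sumF-Idʳ s χ)))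
                    value
      where
      arith : ∀ K P N c → K *ℚ 0ℚ -ℚ c ≡ (P +ℚ N *ℚ c) *ℚ 0ℚ -ℚ 0ℚ -ℚ c *ℚ 1ℚ
      arith = solve-∀ ℚ-ring
      value : K *ℚ 0ℚ -ℚ χ s ≡ ((P +ℚ N *ℚ χ s) ⊛ e (n ↑ʳ s) ⊖ 𝟙K ⊖ χ s ⊛ 𝟙G) (a ↑ˡ p)
      value rewrite Id-↑ʳ↑ˡ {n} s a | splitAt-↑ˡ n a p = arith K P N (χ s)
    row-K : ∀ t → (P +ℚ N *ℚ χ t) *ℚ Id s t -ℚ χ t *ℚ sumF {n} (λ _ → 0ℚ) -ℚ sumF (e s)
                  ≡ ((P +ℚ N *ℚ χ s) ⊛ e (n ↑ʳ s) ⊖ 𝟙K ⊖ χ s ⊛ 𝟙G) (n ↑ʳ t)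
    row-K t = trans (cong₂ (λ a b → a -ℚ χ t *ℚ b -ℚ sumF (e s))
                       (*-Id-subst (λ u → P +ℚ N *ℚ χ u) s t) (sumF-zero n))
                (trans (cong (λ b → (P +ℚ N *ℚ χ s) *ℚ Id s t -ℚ χ t *ℚ 0ℚ -ℚ b) (sumF-Id s))
                  value)
      where
      arith : ∀ d i c c′ → d *ℚ i -ℚ c′ *ℚ 0ℚ -ℚ 1ℚ ≡ d *ℚ i -ℚ 1ℚ -ℚ c *ℚ 0ℚ
      arith = solve-∀ ℚ-ring
      value : (P +ℚ N *ℚ χ s) *ℚ Id s t -ℚ χ t *ℚ 0ℚ -ℚ 1ℚ ≡ ((P +ℚ N *ℚ χ s) ⊛ e (n ↑ʳ s) ⊖ 𝟙K ⊖ χ s ⊛ 𝟙G) (n ↑ʳ t)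
      value rewrite Id-↑ʳ↑ʳ {n} s t | splitAt-↑ʳ n p t = arith (P +ℚ N *ℚ χ s) (Id s t) (χ s) (χ t)

  L▹𝟙G : L ▹ 𝟙G ≗ K ⊛ 𝟙G ⊖ N ⊛ χT
  L▹𝟙G = L▹glue (λ _ → 1ℚ) (λ _ → 0ℚ) row-G row-K
    where
    row-G : ∀ a → (LG+kI ▹ (λ _ → 1ℚ)) a -ℚ sumF (λ t → χ t *ℚ 0ℚ) ≡ (K ⊛ 𝟙G ⊖ N ⊛ χT) (a ↑ˡ p)
    row-G a = trans (cong₂ _-ℚ_ (LG+kI▹const 1ℚ a) sumF-χ*0) value
      where
      arith : ∀ K N → K *ℚ 1ℚ -ℚ 0ℚ ≡ K *ℚ 1ℚ -ℚ N *ℚ 0ℚ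
      arith = solve-∀ ℚ-ring
      value : K *ℚ 1ℚ -ℚ 0ℚ ≡ (K ⊛ 𝟙G ⊖ N ⊛ χT) (a ↑ˡ p)
      value rewrite splitAt-↑ˡ n a p = arith K N
    row-K : ∀ s → (P +ℚ N *ℚ χ s) *ℚ 0ℚ -ℚ χ s *ℚ sumF {n} (λ _ → 1ℚ) -ℚ sumF {p} (λ _ → 0ℚ)
                  ≡ (K ⊛ 𝟙G ⊖ N ⊛ χT) (n ↑ʳ s)
    row-K s = trans (cong₂ (λ a b → (P +ℚ N *ℚ χ s) *ℚ 0ℚ -ℚ χ s *ℚ a -ℚ b)
                      (trans (sumF-const n 1ℚ) (ℚ.*-identityʳ N)) (sumF-zero p))
                    value
      where
      arith : ∀ K N P c → (P +ℚ N *ℚ c) *ℚ 0ℚ -ℚ c *ℚ N -ℚ 0ℚ ≡ K *ℚ 0ℚ -ℚ N *ℚ c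
      arith = solve-∀ ℚ-ring
      value : (P +ℚ N *ℚ χ s) *ℚ 0ℚ -ℚ χ s *ℚ N -ℚ 0ℚ ≡ (K ⊛ 𝟙G ⊖ N ⊛ χT) (n ↑ʳ s)
      value rewrite splitAt-↑ʳ n p s = arith K N P (χ s)

  L▹χT : L ▹ χT ≗ (N +ℚ P) ⊛ χT ⊖ K ⊛ 𝟙K ⊖ K ⊛ 𝟙G
  L▹χT = L▹glue (λ _ → 0ℚ) χ row-G row-K
    where
    sumF-χ² : sumF (λ t → χ t *ℚ χ t) ≡ K
    sumF-χ² = trans (sumF-cong (χ<-idem {p} k)) (sumF-χ< p k k≤p)
    row-G : ∀ a → (LG+kI ▹ (λ _ → 0ℚ)) a -ℚ sumF (λ t → χ t *ℚ χ t)
                  ≡ ((N +ℚ P) ⊛ χT ⊖ K ⊛ 𝟙K ⊖ K ⊛ 𝟙G) (a ↑ˡ p)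
    row-G a = trans (cong₂ _-ℚ_ (LG+kI▹const 0ℚ a) sumF-χ²) value
      where
      arith : ∀ K N P → K *ℚ 0ℚ -ℚ K ≡ (N +ℚ P) *ℚ 0ℚ -ℚ K *ℚ 0ℚ -ℚ K *ℚ 1ℚ
      arith = solve-∀ ℚ-ring
      value : K *ℚ 0ℚ -ℚ K ≡ ((N +ℚ P) ⊛ χT ⊖ K ⊛ 𝟙K ⊖ K ⊛ 𝟙G) (a ↑ˡ p)
      value rewrite splitAt-↑ˡ n a p = arith K N P
    row-K : ∀ s → (P +ℚ N *ℚ χ s) *ℚ χ s -ℚ χ s *ℚ sumF {n} (λ _ → 0ℚ) -ℚ sumF χ
                  ≡ ((N +ℚ P) ⊛ χT ⊖ K ⊛ 𝟙K ⊖ K ⊛ 𝟙G) (n ↑ʳ s)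
    row-K s = begin
      (P +ℚ N *ℚ χ s) *ℚ χ s -ℚ χ s *ℚ sumF {n} (λ _ → 0ℚ) -ℚ sumF χ
        ≡⟨ cong₂ (λ a b → (P +ℚ N *ℚ χ s) *ℚ χ s -ℚ χ s *ℚ a -ℚ b) (sumF-zero n) (sumF-χ< p k k≤p) ⟩
      (P +ℚ N *ℚ χ s) *ℚ χ s -ℚ χ s *ℚ 0ℚ -ℚ K
        ≡⟨ expand P N (χ s) K ⟩
      P *ℚ χ s +ℚ N *ℚ (χ s *ℚ χ s) -ℚ K
        ≡⟨ cong (λ c → P *ℚ χ s +ℚ N *ℚ c -ℚ K) (χ<-idem k s) ⟩
      P *ℚ χ s +ℚ N *ℚ χ s -ℚ K
        ≡⟨ value ⟩
      ((N +ℚ P) ⊛ χT ⊖ K ⊛ 𝟙K ⊖ K ⊛ 𝟙G) (n ↑ʳ s)  ∎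
      where
      open ≡-Reasoning
      expand : ∀ P N c K → (P +ℚ N *ℚ c) *ℚ c -ℚ c *ℚ 0ℚ -ℚ K ≡ P *ℚ c +ℚ N *ℚ (c *ℚ c) -ℚ K
      expand = solve-∀ ℚ-ring
      arith : ∀ K N P c → P *ℚ c +ℚ N *ℚ c -ℚ K ≡ (N +ℚ P) *ℚ c -ℚ K *ℚ 1ℚ -ℚ K *ℚ 0ℚ
      arith = solve-∀ ℚ-ring
      value : P *ℚ χ s +ℚ N *ℚ χ s -ℚ K ≡ ((N +ℚ P) ⊛ χT ⊖ K ⊛ 𝟙K ⊖ K ⊛ 𝟙G) (n ↑ʳ s)
      value rewrite splitAt-↑ʳ n p s = arith K N P (χ s)

-- Resistances in K_p ∘_k (G_n ∨ K_k)

module Resistances (n k p : ℕ) {{_ : NonZero k}} (k≤p : k ≤ p) (G : Graph n) (G-simple : IsSimple G)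
                   (M : Mat n) (inv : IsInverse (shiftDiag (Laplacian G) k) M)
                   (X : Mat (n + p)) (gi : IsGroupInverse (Laplacian (composite n k p G)) X) where

  open Join n k p k≤p G

  instance
    p≢0 : NonZero p
    p≢0 = >-nonZero (ℕ.<-≤-trans (>-nonZero⁻¹ k) k≤p)
    p+n≢0 : NonZero (p + n)
    p+n≢0 = >-nonZero (ℕ.<-≤-trans (>-nonZero⁻¹ p) (ℕ.m≤m+n p n))
    k*p≢0 : NonZero (k * p)
    k*p≢0 = ℕ.m*n≢0 k p
    k*[p+n]≢0 : NonZero (k * (p + n))
    k*[p+n]≢0 = ℕ.m*n≢0 k (p + n)
    k*p*[p+n]≢0 : NonZero (k * p * (p + n))
    k*p*[p+n]≢0 = ℕ.m*n≢0 (k * p) (p + n)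

  L-symmetric : Symmetric L
  L-symmetric = Laplacian-symmetric (H-sym (proj₁ G-simple))

  LG+kI-symmetric : Symmetric LG+kI
  LG+kI-symmetric = shiftDiag-symmetric k (Laplacian-symmetric (proj₁ G-simple))

  M-symmetric : Symmetric M
  M-symmetric = groupInverse-symmetric LG+kI-symmetric (inverse⇒groupInverse inv)

  K*columnSum : ∀ j → K *ℚ sumF (λ a → M a j) ≡ 1ℚ
  K*columnSum j = begin
    K *ℚ sumF (λ a → M a j)                      ≡⟨ sumF-* K (λ a → M a j) ⟨
    sumF (λ a → K *ℚ M a j)                      ≡⟨ sumF-cong (λ a → cong (_*ℚ M a j) (trans (LG+kI▹const 1ℚ a) (ℚ.*-identityʳ K))) ⟨
    dot (LG+kI ▹ (λ _ → 1ℚ)) (λ a → M a j)       ≡⟨ dot-▹ LG+kI-symmetric (λ _ → 1ℚ) (λ a → M a j) ⟩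
    dot (λ _ → 1ℚ) (LG+kI ▹ (λ a → M a j))       ≡⟨ sumF-cong (λ a → cong (1ℚ *ℚ_) (proj₁ inv a j)) ⟩
    sumF (λ a → 1ℚ *ℚ Id a j)                    ≡⟨ sumF-Idʳ j (λ _ → 1ℚ) ⟩
    1ℚ                                           ∎
    where open ≡-Reasoning

  ν : Fin n → Vector (n + p)
  ν j = glue (λ a → K *ℚ M a j) (λ _ → 0ℚ)

  L▹ν : ∀ j → L ▹ ν j ≗ K ⊛ e (j ↑ˡ p) ⊖ χT
  L▹ν j = L▹glue (λ a → K *ℚ M a j) (λ _ → 0ℚ) row-G row-K
    where
    row-G : ∀ a → (LG+kI ▹ (λ b → K *ℚ M b j)) a -ℚ sumF (λ t → χ t *ℚ 0ℚ) ≡ (K ⊛ e (j ↑ˡ p) ⊖ χT) (a ↑ˡ p)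
    row-G a = trans (cong₂ _-ℚ_ (▹-⊛ {A = LG+kI} K (λ b → proj₁ inv b j) a) sumF-χ*0) value
      where
      value : K *ℚ Id a j -ℚ 0ℚ ≡ (K ⊛ e (j ↑ˡ p) ⊖ χT) (a ↑ˡ p)
      value rewrite Id-↑ˡ↑ˡ {n = p} j a | splitAt-↑ˡ n a p | Id-sym a j = refl
    row-K : ∀ s → (P +ℚ N *ℚ χ s) *ℚ 0ℚ -ℚ χ s *ℚ sumF (λ a → K *ℚ M a j) -ℚ sumF {p} (λ _ → 0ℚ)
                  ≡ (K ⊛ e (j ↑ˡ p) ⊖ χT) (n ↑ʳ s)
    row-K s = trans (cong₂ (λ a b → (P +ℚ N *ℚ χ s) *ℚ 0ℚ -ℚ χ s *ℚ a -ℚ b)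
                      (trans (sumF-* K (λ a → M a j)) (K*columnSum j)) (sumF-zero p))
                    value
      where
      arith : ∀ K P N c → (P +ℚ N *ℚ c) *ℚ 0ℚ -ℚ c *ℚ 1ℚ -ℚ 0ℚ ≡ K *ℚ 0ℚ -ℚ c
      arith = solve-∀ ℚ-ring
      value : (P +ℚ N *ℚ χ s) *ℚ 0ℚ -ℚ χ s *ℚ 1ℚ -ℚ 0ℚ ≡ (K ⊛ e (j ↑ˡ p) ⊖ χT) (n ↑ʳ s)
      value rewrite Id-↑ˡ↑ʳ j s | splitAt-↑ʳ n p s = arith K P N (χ s)

  L▹e-T : ∀ {s} → toℕ s < k → L ▹ e (n ↑ʳ s) ≗ (P +ℚ N) ⊛ e (n ↑ʳ s) ⊖ (𝟙K ⊕ 𝟙G)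
  L▹e-T {s} s<k w = trans (L▹e-↑ʳ s w) value
    where
    arith : ∀ P N x o g → (P +ℚ N *ℚ 1ℚ) *ℚ x -ℚ o -ℚ 1ℚ *ℚ g ≡ (P +ℚ N) *ℚ x -ℚ (o +ℚ g)
    arith = solve-∀ ℚ-ring
    value : ((P +ℚ N *ℚ χ s) ⊛ e (n ↑ʳ s) ⊖ 𝟙K ⊖ χ s ⊛ 𝟙G) w ≡ ((P +ℚ N) ⊛ e (n ↑ʳ s) ⊖ (𝟙K ⊕ 𝟙G)) w
    value rewrite χ<-< {k = k} {s} s<k = arith P N (e (n ↑ʳ s) w) (𝟙K w) (𝟙G w)

  L▹e-K∖T : ∀ {s} → k ≤ toℕ s → L ▹ e (n ↑ʳ s) ≗ P ⊛ e (n ↑ʳ s) ⊖ 𝟙K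
  L▹e-K∖T {s} k≤s w = trans (L▹e-↑ʳ s w) value
    where
    arith : ∀ P N x o g → (P +ℚ N *ℚ 0ℚ) *ℚ x -ℚ o -ℚ 0ℚ *ℚ g ≡ P *ℚ x -ℚ o
    arith = solve-∀ ℚ-ring
    value : ((P +ℚ N *ℚ χ s) ⊛ e (n ↑ʳ s) ⊖ 𝟙K ⊖ χ s ⊛ 𝟙G) w ≡ (P ⊛ e (n ↑ʳ s) ⊖ 𝟙K) w
    value rewrite χ<-≥ {k = k} {s} k≤s = arith P N (e (n ↑ʳ s) w) (𝟙K w) (𝟙G w)

  scaled-resistance : ∀ D .{{_ : NonZero D}} {c} → ℕtoℚ D ≡ c → ∀ {z u v} →
                      L ▹ z ≗ c ⊛ (e u ⊖ e v) → ℕtoℚ D *ℚ resistance X u v ≡ z u -ℚ z v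
  scaled-resistance = scaledPotential⇒resistance L-symmetric gi

  resistance-T-T : ∀ s t → toℕ s < k → toℕ t < k → s ≢ t →
                   resistance X (n ↑ʳ s) (n ↑ʳ t) ≡ frac 2 (p + n)
  resistance-T-T s t s<k t<k s≢t = frac-unique 2 (p + n)
    (twins⇒resistance L-symmetric gi (p + n) (ℕtoℚ-+ p n) (s≢t ∘ ↑ʳ-injective n s t) (L▹e-T s<k) (L▹e-T t<k))

  resistance-T-K∖T : ∀ s t → toℕ s < k → k ≤ toℕ t →
                     resistance X (n ↑ʳ s) (n ↑ʳ t) ≡ frac (k * (2 * p + n) + n) (k * p * (p + n))
  resistance-T-K∖T s t s<k k≤t = frac-unique (k * (2 * p + n) + n) (k * p * (p + n)) (begin
    ℕtoℚ (k * p * (p + n)) *ℚ resistance X u v  ≡⟨ scaled-resistance (k * p * (p + n)) scale image ⟩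
    z u -ℚ z v                                  ≡⟨ value ⟩
    K *ℚ (ℕtoℚ 2 *ℚ P +ℚ N) +ℚ N                ≡⟨ numerator ⟨
    ℕtoℚ (k * (2 * p + n) + n)                  ∎)
    where
    open ≡-Reasoning
    u = n ↑ʳ s
    v = n ↑ʳ t
    u≢v : u ≢ v
    u≢v u≡v = ℕ.<⇒≱ s<k (subst (λ r → k ≤ toℕ r) (sym (↑ʳ-injective n s t u≡v)) k≤t)
    -- The coefficients make the 𝟙K-, 𝟙G- and χT-components of L z cancel.
    z : Vector (n + p)
    z = K *ℚ P ⊛ e u ⊖ K *ℚ (N +ℚ P) ⊛ e v ⊕ (N +ℚ P) ⊛ 𝟙G ⊕ N ⊛ χT
    scale : ℕtoℚ (k * p * (p + n)) ≡ K *ℚ P *ℚ (P +ℚ N)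
    scale = trans (ℕtoℚ-* (k * p) (p + n)) (cong₂ _*ℚ_ (ℕtoℚ-* k p) (ℕtoℚ-+ p n))
    numerator : ℕtoℚ (k * (2 * p + n) + n) ≡ K *ℚ (ℕtoℚ 2 *ℚ P +ℚ N) +ℚ N
    numerator = trans (ℕtoℚ-+ (k * (2 * p + n)) n) (cong (_+ℚ N) (trans (ℕtoℚ-* k (2 * p + n))
                  (cong (K *ℚ_) (trans (ℕtoℚ-+ (2 * p) n) (cong (_+ℚ N) (ℕtoℚ-* 2 p))))))
    combine : ∀ K N P x y o g c →
      K *ℚ P *ℚ ((P +ℚ N) *ℚ x -ℚ (o +ℚ g)) -ℚ K *ℚ (N +ℚ P) *ℚ (P *ℚ y -ℚ o)
        +ℚ (N +ℚ P) *ℚ (K *ℚ g -ℚ N *ℚ c) +ℚ N *ℚ ((N +ℚ P) *ℚ c -ℚ K *ℚ o -ℚ K *ℚ g)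
      ≡ K *ℚ P *ℚ (P +ℚ N) *ℚ (x -ℚ y)
    combine = solve-∀ ℚ-ring
    image : L ▹ z ≗ K *ℚ P *ℚ (P +ℚ N) ⊛ (e u ⊖ e v)
    image w = trans (▹-⊕ {A = L} (▹-⊕ {A = L} (▹-⊖ {A = L} (▹-⊛ {A = L} (K *ℚ P) (L▹e-T s<k))
                                                       (▹-⊛ {A = L} (K *ℚ (N +ℚ P)) (L▹e-K∖T k≤t)))
                                          (▹-⊛ {A = L} (N +ℚ P) L▹𝟙G))
                             (▹-⊛ {A = L} N L▹χT) w)
                    (combine K N P (e u w) (e v w) (𝟙K w) (𝟙G w) (χT w))
    cong-atoms : ∀ {a a′ b b′ c c′ d d′} → a ≡ a′ → b ≡ b′ → c ≡ c′ → d ≡ d′ →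
         K *ℚ P *ℚ a -ℚ K *ℚ (N +ℚ P) *ℚ b +ℚ (N +ℚ P) *ℚ c +ℚ N *ℚ d
           ≡ K *ℚ P *ℚ a′ -ℚ K *ℚ (N +ℚ P) *ℚ b′ +ℚ (N +ℚ P) *ℚ c′ +ℚ N *ℚ d′
    cong-atoms refl refl refl refl = refl
    evaluate : ∀ K N P →
      (K *ℚ P *ℚ 1ℚ -ℚ K *ℚ (N +ℚ P) *ℚ 0ℚ +ℚ (N +ℚ P) *ℚ 0ℚ +ℚ N *ℚ 1ℚ)
        -ℚ (K *ℚ P *ℚ 0ℚ -ℚ K *ℚ (N +ℚ P) *ℚ 1ℚ +ℚ (N +ℚ P) *ℚ 0ℚ +ℚ N *ℚ 0ℚ)
      ≡ K *ℚ (ℕtoℚ 2 *ℚ P +ℚ N) +ℚ N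
    evaluate = solve-∀ ℚ-ring
    value : z u -ℚ z v ≡ K *ℚ (ℕtoℚ 2 *ℚ P +ℚ N) +ℚ N
    value = trans (cong₂ _-ℚ_
      (cong-atoms (Id-refl u) (Id-≢ (u≢v ∘ sym)) (glue-↑ʳ _ _ s) (trans (glue-↑ʳ _ _ s) (χ<-< s<k)))
      (cong-atoms (Id-≢ u≢v) (Id-refl v) (glue-↑ʳ _ _ t) (trans (glue-↑ʳ _ _ t) (χ<-≥ k≤t))))
      (evaluate K N P)

  resistance-T-G : ∀ s j → toℕ s < k →
                   resistance X (n ↑ʳ s) (j ↑ˡ p) ≡ frac (k ∸ 1) (k * (p + n)) +ℚ M j j
  resistance-T-G s j s<k = frac-+-unique (k ∸ 1) (k * (p + n)) (begin
    ℕtoℚ (k * (p + n)) *ℚ resistance X u v          ≡⟨ scaled-resistance (k * (p + n)) scale image ⟩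
    z u -ℚ z v                                      ≡⟨ value ⟩
    (K -ℚ 1ℚ) +ℚ K *ℚ (P +ℚ N) *ℚ M j j             ≡⟨ cong₂ _+ℚ_ (ℕtoℚ-∸1 k) (cong (_*ℚ M j j) scale) ⟨
    ℕtoℚ (k ∸ 1) +ℚ ℕtoℚ (k * (p + n)) *ℚ M j j     ∎)
    where
    open ≡-Reasoning
    u = n ↑ʳ s
    v = j ↑ˡ p
    z : Vector (n + p)
    z = K ⊛ e u ⊖ χT ⊖ (N +ℚ P) ⊛ ν j
    scale : ℕtoℚ (k * (p + n)) ≡ K *ℚ (P +ℚ N)
    scale = trans (ℕtoℚ-* k (p + n)) (cong (K *ℚ_) (ℕtoℚ-+ p n))
    combine : ∀ K N P x y o g c →
      K *ℚ ((P +ℚ N) *ℚ x -ℚ (o +ℚ g)) -ℚ ((N +ℚ P) *ℚ c -ℚ K *ℚ o -ℚ K *ℚ g) -ℚ (N +ℚ P) *ℚ (K *ℚ y -ℚ c)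
      ≡ K *ℚ (P +ℚ N) *ℚ (x -ℚ y)
    combine = solve-∀ ℚ-ring
    image : L ▹ z ≗ K *ℚ (P +ℚ N) ⊛ (e u ⊖ e v)
    image w = trans (▹-⊖ {A = L} (▹-⊖ {A = L} (▹-⊛ {A = L} K (L▹e-T s<k)) L▹χT) (▹-⊛ {A = L} (N +ℚ P) (L▹ν j)) w)
                    (combine K N P (e u w) (e v w) (𝟙K w) (𝟙G w) (χT w))
    cong-atoms : ∀ {a a′ b b′ c c′} → a ≡ a′ → b ≡ b′ → c ≡ c′ →
         K *ℚ a -ℚ b -ℚ (N +ℚ P) *ℚ c ≡ K *ℚ a′ -ℚ b′ -ℚ (N +ℚ P) *ℚ c′
    cong-atoms refl refl refl = refl
    evaluate : ∀ K N P m → (K *ℚ 1ℚ -ℚ 1ℚ -ℚ (N +ℚ P) *ℚ 0ℚ) -ℚ (K *ℚ 0ℚ -ℚ 0ℚ -ℚ (N +ℚ P) *ℚ (K *ℚ m))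
                           ≡ (K -ℚ 1ℚ) +ℚ K *ℚ (P +ℚ N) *ℚ m
    evaluate = solve-∀ ℚ-ring
    value : z u -ℚ z v ≡ (K -ℚ 1ℚ) +ℚ K *ℚ (P +ℚ N) *ℚ M j j
    value = trans (cong₂ _-ℚ_
      (cong-atoms (Id-refl u) (trans (glue-↑ʳ _ _ s) (χ<-< s<k)) (glue-↑ʳ _ _ s))
      (cong-atoms (Id-↑ʳ↑ˡ s j) (glue-↑ˡ _ _ j) (glue-↑ˡ _ _ j)))
      (evaluate K N P (M j j))

  resistance-K∖T-K∖T : ∀ s t → k ≤ toℕ s → k ≤ toℕ t → s ≢ t →
                       resistance X (n ↑ʳ s) (n ↑ʳ t) ≡ frac 2 p
  resistance-K∖T-K∖T s t k≤s k≤t s≢t = frac-unique 2 p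
    (twins⇒resistance L-symmetric gi p refl (s≢t ∘ ↑ʳ-injective n s t) (L▹e-K∖T k≤s) (L▹e-K∖T k≤t))

  resistance-K∖T-G : ∀ s j → k ≤ toℕ s →
                     resistance X (n ↑ʳ s) (j ↑ˡ p) ≡ frac (k + 1) (k * p) +ℚ M j j
  resistance-K∖T-G s j k≤s = frac-+-unique (k + 1) (k * p) (begin
    ℕtoℚ (k * p) *ℚ resistance X u v          ≡⟨ scaled-resistance (k * p) (ℕtoℚ-* k p) image ⟩
    z u -ℚ z v                                ≡⟨ value ⟩
    (K +ℚ 1ℚ) +ℚ K *ℚ P *ℚ M j j              ≡⟨ cong₂ _+ℚ_ (ℕtoℚ-+ k 1) (cong (_*ℚ M j j) (ℕtoℚ-* k p)) ⟨
    ℕtoℚ (k + 1) +ℚ ℕtoℚ (k * p) *ℚ M j j     ∎)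
    where
    open ≡-Reasoning
    u = n ↑ʳ s
    v = j ↑ˡ p
    z : Vector (n + p)
    z = K ⊛ e u ⊖ 𝟙G ⊖ χT ⊖ P ⊛ ν j
    combine : ∀ K N P x y o g c →
      K *ℚ (P *ℚ x -ℚ o) -ℚ (K *ℚ g -ℚ N *ℚ c) -ℚ ((N +ℚ P) *ℚ c -ℚ K *ℚ o -ℚ K *ℚ g) -ℚ P *ℚ (K *ℚ y -ℚ c)
      ≡ K *ℚ P *ℚ (x -ℚ y)
    combine = solve-∀ ℚ-ring
    image : L ▹ z ≗ K *ℚ P ⊛ (e u ⊖ e v)
    image w = trans (▹-⊖ {A = L} (▹-⊖ {A = L} (▹-⊖ {A = L} (▹-⊛ {A = L} K (L▹e-K∖T k≤s)) L▹𝟙G) L▹χT)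
                                 (▹-⊛ {A = L} P (L▹ν j)) w)
                    (combine K N P (e u w) (e v w) (𝟙K w) (𝟙G w) (χT w))
    cong-atoms : ∀ {a a′ b b′ c c′ d d′} → a ≡ a′ → b ≡ b′ → c ≡ c′ → d ≡ d′ →
         K *ℚ a -ℚ b -ℚ c -ℚ P *ℚ d ≡ K *ℚ a′ -ℚ b′ -ℚ c′ -ℚ P *ℚ d′
    cong-atoms refl refl refl refl = refl
    evaluate : ∀ K P m → (K *ℚ 1ℚ -ℚ 0ℚ -ℚ 0ℚ -ℚ P *ℚ 0ℚ) -ℚ (K *ℚ 0ℚ -ℚ 1ℚ -ℚ 0ℚ -ℚ P *ℚ (K *ℚ m))
                         ≡ (K +ℚ 1ℚ) +ℚ K *ℚ P *ℚ m
    evaluate = solve-∀ ℚ-ring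
    value : z u -ℚ z v ≡ (K +ℚ 1ℚ) +ℚ K *ℚ P *ℚ M j j
    value = trans (cong₂ _-ℚ_
      (cong-atoms (Id-refl u) (glue-↑ʳ _ _ s) (trans (glue-↑ʳ _ _ s) (χ<-≥ k≤s)) (glue-↑ʳ _ _ s))
      (cong-atoms (Id-↑ʳ↑ˡ s j) (glue-↑ˡ _ _ j) (glue-↑ˡ _ _ j) (glue-↑ˡ _ _ j)))
      (evaluate K P (M j j))

  resistance-G-G : ∀ i j → i ≢ j → resistance X (i ↑ˡ p) (j ↑ˡ p) ≡ (M i i +ℚ M j j) -ℚ (frac 2 1 *ℚ M i j)
  resistance-G-G i j i≢j = ℕtoℚ-*-cancelˡ k (trans (scaled-resistance k refl image) value)
    where
    arith : ∀ K x y c → (K *ℚ x -ℚ c) -ℚ (K *ℚ y -ℚ c) ≡ K *ℚ (x -ℚ y)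
    arith = solve-∀ ℚ-ring
    image : L ▹ (ν i ⊖ ν j) ≗ K ⊛ (e (i ↑ˡ p) ⊖ e (j ↑ˡ p))
    image w = trans (▹-⊖ {A = L} (L▹ν i) (L▹ν j) w) (arith K (e (i ↑ˡ p) w) (e (j ↑ˡ p) w) (χT w))
    collect : ∀ K a b c → (K *ℚ a -ℚ K *ℚ c) -ℚ (K *ℚ c -ℚ K *ℚ b) ≡ K *ℚ ((a +ℚ b) -ℚ ℕtoℚ 2 *ℚ c)
    collect = solve-∀ ℚ-ring
    value : (ν i ⊖ ν j) (i ↑ˡ p) -ℚ (ν i ⊖ ν j) (j ↑ˡ p) ≡ K *ℚ ((M i i +ℚ M j j) -ℚ (frac 2 1 *ℚ M i j))
    value = trans (cong₂ _-ℚ_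
                    (cong₂ _-ℚ_ (glue-↑ˡ (λ a → K *ℚ M a i) _ i) (glue-↑ˡ (λ a → K *ℚ M a j) _ i))
                    (cong₂ _-ℚ_ (glue-↑ˡ (λ a → K *ℚ M a i) _ j) (glue-↑ˡ (λ a → K *ℚ M a j) _ j)))
              (trans (cong (λ m → (K *ℚ M i i -ℚ K *ℚ M i j) -ℚ (K *ℚ m -ℚ K *ℚ M j j)) (M-symmetric j i))
                     (collect K (M i i) (M j j) (M i j)))

theorem3p2 : (n k p : ℕ) (G : Graph n) → IsSimple G → 1 ≤ k → k ≤ p →
    (M : Mat n) → IsInverse (shiftDiag (Laplacian G) k) M →
    (X : Mat (n + p)) → IsGroupInverse (Laplacian (composite n k p G)) X →
    ((s t : Fin p) → toℕ s < k → toℕ t < k → s ≢ t →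
      resistance X (n ↑ʳ s) (n ↑ʳ t) ≡ frac 2 (p + n))
    × ((s t : Fin p) → toℕ s < k → k ≤ toℕ t →
      resistance X (n ↑ʳ s) (n ↑ʳ t) ≡ frac (k * (2 * p + n) + n) (k * p * (p + n)))
    × ((s : Fin p) (j : Fin n) → toℕ s < k →
      resistance X (n ↑ʳ s) (j ↑ˡ p) ≡ frac (k ∸ 1) (k * (p + n)) +ℚ M j j)
    × ((s t : Fin p) → k ≤ toℕ s → k ≤ toℕ t → s ≢ t →
      resistance X (n ↑ʳ s) (n ↑ʳ t) ≡ frac 2 p)
    × ((s : Fin p) (j : Fin n) → k ≤ toℕ s →
      resistance X (n ↑ʳ s) (j ↑ˡ p) ≡ frac (k + 1) (k * p) +ℚ M j j)
    × ((i j : Fin n) → i ≢ j →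
      resistance X (i ↑ˡ p) (j ↑ˡ p) ≡ (M i i +ℚ M j j) -ℚ (frac 2 1 *ℚ M i j))
theorem3p2 n k p G G-simple 1≤k k≤p M inv X gi =
  resistance-T-T , resistance-T-K∖T , resistance-T-G ,
  resistance-K∖T-K∖T , resistance-K∖T-G , resistance-G-G
  where open Resistances n k p {{>-nonZero 1≤k}} k≤p G G-simple M inv X gi
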